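{- Let $K$ be a field, $n\le r$, and let $(A_1,\ldots,A_p)$ be a tuple of matrices in $M_n(K)$ having a commuting extension $(Z_1,\ldots,Z_p)$ of size $r$, with $Z_i=\begin{pmatrix} A_i & B_i\\ C_i & D_i\end{pmatrix}$. For any pairwise distinct indices $k,l,m\in\{1,\ldots,p\}$, the space $V_{klm}=\operatorname{Im}[A_k,A_l]+\operatorname{Im}[A_k,A_m]$ satisfies $\dim V_{klm}\le 3(r-n)$. If equality holds, then $r\le 4n/3$, the matrices $B_k,B_l,B_m$ have rank $r-n$, and $V_{klm}=\operatorname{Im}(B_k)\oplus\operatorname{Im}(B_l)\oplus\operatorname{Im}(B_m)$.
   Context: $[A,B]=AB-BA$, $\operatorname{Im}A$ is the column space. A commuting extension of size $r$ of $(A_1,\ldots,A_p)$ is a tuple of pairwise commuting $r\times r$ matrices $Z_i=\begin{pmatrix} A_i & B_i\\ C_i & D_i\end{pmatrix}$ with $B_i\in M_{n,r-n}(K)$, $C_i\in M_{r-n,n}(K)$, $D_i\in M_{r-n}(K)$. -}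

module Defs where

open import Level using (Level; _⊔_; 0ℓ) renaming (suc to lsuc)
open import Algebra.Bundles using (CommutativeRing)
import Algebra.Definitions.RawMonoid as RawMonoidDefs
open import Data.Nat using (ℕ) renaming (_+_ to _+ℕ_; _≤_ to _≤ℕ_)
open import Data.Fin using (Fin; splitAt; _↑ˡ_; _↑ʳ_)
open import Data.Sum using (inj₁; inj₂)
open import Data.Product using (Σ; ∃; _×_; _,_)
open import Relation.Nullary using (¬_)

record Field (c ℓ : Level) : Set (lsuc (c ⊔ ℓ)) where
  field
    commutativeRing : CommutativeRing c ℓ
  open CommutativeRing commutativeRing public
  field
    0≉1     : ¬ (0# ≈ 1#)
    inverse : ∀ x → ¬ (x ≈ 0#) → ∃ λ y → x * y ≈ 1#

module LinearAlgebra {c ℓ : Level} (K : Field c ℓ) where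
  open Field K
  open RawMonoidDefs +-rawMonoid using (sum)

  Vec : ℕ → Set c
  Vec n = Fin n → Carrier

  Matrix : ℕ → ℕ → Set c
  Matrix m k = Fin m → Fin k → Carrier

  _≈ᵛ_ : ∀ {n} → Vec n → Vec n → Set ℓ
  u ≈ᵛ v = ∀ i → u i ≈ v i

  _+ᵛ_ : ∀ {n} → Vec n → Vec n → Vec n
  (u +ᵛ v) i = u i + v i

  0ᵛ : ∀ {n} → Vec n
  0ᵛ _ = 0#

  _·_ : ∀ {m k} → Matrix m k → Vec k → Vec m
  (M · x) i = sum (λ j → M i j * x j)

  _⊗_ : ∀ {m k q} → Matrix m k → Matrix k q → Matrix m q
  (M ⊗ N) i j = sum (λ t → M i t * N t j)

  _⊖_ : ∀ {m k} → Matrix m k → Matrix m k → Matrix m k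
  (M ⊖ N) i j = M i j - N i j

  _≋_ : ∀ {m k} → Matrix m k → Matrix m k → Set ℓ
  M ≋ N = ∀ i j → M i j ≈ N i j

  ⟦_,_⟧ : ∀ {n} → Matrix n n → Matrix n n → Matrix n n
  ⟦ A , B ⟧ = (A ⊗ B) ⊖ (B ⊗ A)

  block : ∀ {n s} → Matrix n n → Matrix n s → Matrix s n → Matrix s s
        → Matrix (n +ℕ s) (n +ℕ s)
  block {n} A B C D i j with splitAt n i | splitAt n j
  ... | inj₁ a | inj₁ b = A a b
  ... | inj₁ a | inj₂ b = B a b
  ... | inj₂ a | inj₁ b = C a b
  ... | inj₂ a | inj₂ b = D a b

  Subspace : ℕ → Set (lsuc (c ⊔ ℓ))
  Subspace n = Vec n → Set (c ⊔ ℓ)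

  Im : ∀ {m k} → Matrix m k → Subspace m
  Im M v = ∃ λ x → (M · x) ≈ᵛ v

  _⊕ₛ_ : ∀ {n} → Subspace n → Subspace n → Subspace n
  (V ⊕ₛ W) v = ∃ λ a → ∃ λ b → V a × W b × (v ≈ᵛ (a +ᵛ b))

  _≐_ : ∀ {n} → Subspace n → Subspace n → Set (c ⊔ ℓ)
  V ≐ W = (∀ v → V v → W v) × (∀ v → W v → V v)

  LinIndep : ∀ {n d} → (Fin d → Vec n) → Set (c ⊔ ℓ)
  LinIndep {n} {d} f =
    ∀ (a : Fin d → Carrier) → (∀ i → sum (λ j → a j * f j i) ≈ 0#) → ∀ j → a j ≈ 0#

  DimLE : ∀ {n} → Subspace n → ℕ → Set (c ⊔ ℓ)
  DimLE {n} V d = ∀ (k : ℕ) (f : Fin k → Vec n) → (∀ j → V (f j)) → LinIndep f → k ≤ℕ d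

  DimGE : ∀ {n} → Subspace n → ℕ → Set (c ⊔ ℓ)
  DimGE {n} V d = Σ (Fin d → Vec n) λ f → (∀ j → V (f j)) × LinIndep f

  Dim : ∀ {n} → Subspace n → ℕ → Set (c ⊔ ℓ)
  Dim V d = DimLE V d × DimGE V d

  Rank : ∀ {m k} → Matrix m k → ℕ → Set (c ⊔ ℓ)
  Rank M d = Dim (Im M) d

  -- Im B₁ + Im B₂ + Im B₃ is a direct sum
  DirectSum₃ : ∀ {n s} → Matrix n s → Matrix n s → Matrix n s → Set (c ⊔ ℓ)
  DirectSum₃ B₁ B₂ B₃ = ∀ x y z → (((B₁ · x) +ᵛ (B₂ · y)) +ᵛ (B₃ · z)) ≈ᵛ 0ᵛ
    → ((B₁ · x) ≈ᵛ 0ᵛ) × ((B₂ · y) ≈ᵛ 0ᵛ) × ((B₃ · z) ≈ᵛ 0ᵛ)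

module Submission where

-- Comparing the top-left blocks of Z_a Z_b = Z_b Z_a gives [A_a, A_b] = B_b C_a − B_a C_b, hence
--   [A_k, A_l] x + [A_k, A_m] y = B_k (− C_l x − C_m y) + B_l C_k x + B_m C_k y,
-- so V_klm lies in the image of the n × 3s matrix M = (B_k | B_l | B_m), s = r − n, and
-- dim V_klm ≤ 3s. If equality holds, preimages under M of a basis of V_klm form an injective
-- 3s × 3s matrix, which is invertible by Cramer's rule. So M is injective with image V_klm, and
-- injectivity of M gives the three ranks, the direct sum and 3s ≤ n, that is 3r ≤ 4n.

open import Defs
open import Algebra.Bundles using (CommutativeRing)

module CommutativeRingSolver {c ℓ} (R : CommutativeRing c ℓ) where

  open import Algebra.Bundles using (RawRing)
  open import Algebra.Solver.Ring.AlmostCommutativeRing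
    using (fromCommutativeRing; _-Raw-AlmostCommutative⟶_; Induced-equivalence)
  open import Data.Maybe using (just; nothing)
  open import Data.Nat as ℕ using (ℕ; zero; suc)
  open import Data.Product using (_,_) renaming (_×_ to _⊗_)
  open import Data.Product.Properties using (≡-dec)
  open import Relation.Binary.Definitions using (WeaklyDecidable)
  open import Relation.Binary.PropositionalEquality using (_≡_; cong)
  open import Relation.Nullary using (yes; no)

  open CommutativeRing R hiding (zero)
  open import Algebra.Properties.Semiring.Mult.TCOptimised semiring using (_×_; ×1-homo-*)
  open import Algebra.Properties.Monoid.Mult.TCOptimised +-monoid using (×-homo-+; 1+×)
  open import Algebra.Properties.Ring ring using (-‿distribˡ-*; -‿distribʳ-*; -0#≈0#; -‿involutive; -‿+-comm)
  open import Relation.Binary.Reasoning.Setoid setoid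

  -- Solver normal forms are compared by computation, so the coefficients must be concrete:
  -- integers, where (a , b) stands for a − b and the operations keep one component zero so
  -- that equal integers have equal representations.
  ℤ₂ : Set
  ℤ₂ = ℕ ⊗ ℕ

  canonical : ℕ → ℕ → ℤ₂
  canonical zero    b       = zero , b
  canonical (suc a) zero    = suc a , zero
  canonical (suc a) (suc b) = canonical a b

  ℤ₂-rawRing : RawRing _ _
  ℤ₂-rawRing = record
    { Carrier = ℤ₂
    ; _≈_ = _≡_
    ; _+_ = λ { (a , b) (c , d) → canonical (a ℕ.+ c) (b ℕ.+ d) }
    ; _*_ = λ { (a , b) (c , d) → canonical (a ℕ.* c ℕ.+ b ℕ.* d) (a ℕ.* d ℕ.+ b ℕ.* c) }
    ; -_ = λ { (a , b) → b , a }
    ; 0# = 0 , 0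
    ; 1# = 1 , 0
    }

  -- Defined so that the constants 0 and 1 denote 0# and 1# definitionally.
  ⟦_⟧ᶻ : ℤ₂ → Carrier
  ⟦ a , zero ⟧ᶻ        = a × 1#
  ⟦ zero , suc b ⟧ᶻ    = - (suc b × 1#)
  ⟦ suc a , suc b ⟧ᶻ   = ⟦ a , b ⟧ᶻ

  ⟦canonical⟧ : ∀ a b → ⟦ canonical a b ⟧ᶻ ≡ ⟦ a , b ⟧ᶻ
  ⟦canonical⟧ zero    zero    = _≡_.refl
  ⟦canonical⟧ zero    (suc b) = _≡_.refl
  ⟦canonical⟧ (suc a) zero    = _≡_.refl
  ⟦canonical⟧ (suc a) (suc b) = ⟦canonical⟧ a b

  -‿+-cancelˡ : ∀ u x y → (u + x) - (u + y) ≈ x - y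
  -‿+-cancelˡ u x y = begin
    (u + x) + - (u + y)   ≈⟨ +-congˡ (sym (-‿+-comm u y)) ⟩
    (u + x) + (- u + - y) ≈⟨ +-assoc u x _ ⟩
    u + (x + (- u + - y)) ≈⟨ +-congˡ (sym (+-assoc x (- u) (- y))) ⟩
    u + ((x + - u) + - y) ≈⟨ +-congˡ (+-congʳ (+-comm x (- u))) ⟩
    u + ((- u + x) + - y) ≈⟨ +-congˡ (+-assoc (- u) x (- y)) ⟩
    u + (- u + (x - y))   ≈⟨ sym (+-assoc u (- u) _) ⟩
    (u - u) + (x - y)     ≈⟨ +-congʳ (-‿inverseʳ u) ⟩
    0# + (x - y)          ≈⟨ +-identityˡ _ ⟩
    x - y                 ∎

  ⟦⟧ᶻ-difference : ∀ a b → ⟦ a , b ⟧ᶻ ≈ a × 1# - b × 1#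
  ⟦⟧ᶻ-difference a       zero    = sym (trans (+-congˡ -0#≈0#) (+-identityʳ _))
  ⟦⟧ᶻ-difference zero    (suc b) = sym (+-identityˡ _)
  ⟦⟧ᶻ-difference (suc a) (suc b) = begin
    ⟦ a , b ⟧ᶻ                      ≈⟨ ⟦⟧ᶻ-difference a b ⟩
    a × 1# - b × 1#                 ≈⟨ sym (-‿+-cancelˡ 1# _ _) ⟩
    (1# + a × 1#) - (1# + b × 1#)   ≈⟨ sym (+-cong (1+× a 1#) (-‿cong (1+× b 1#))) ⟩
    suc a × 1# - suc b × 1#         ∎

  -‿+-interchange : ∀ p q r s → (p + q) - (r + s) ≈ (p - r) + (q - s)
  -‿+-interchange p q r s = begin
    (p + q) + - (r + s)   ≈⟨ +-congˡ (sym (-‿+-comm r s)) ⟩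
    (p + q) + (- r + - s) ≈⟨ +-assoc p q _ ⟩
    p + (q + (- r + - s)) ≈⟨ +-congˡ (sym (+-assoc q (- r) (- s))) ⟩
    p + ((q + - r) + - s) ≈⟨ +-congˡ (+-congʳ (+-comm q (- r))) ⟩
    p + ((- r + q) + - s) ≈⟨ +-congˡ (+-assoc (- r) q (- s)) ⟩
    p + (- r + (q - s))   ≈⟨ sym (+-assoc p (- r) _) ⟩
    (p - r) + (q - s)     ∎

  -‿*-difference : ∀ w x y z → (w - x) * (y - z) ≈ (w * y + x * z) - (w * z + x * y)
  -‿*-difference w x y z = begin
    (w - x) * (y - z)                           ≈⟨ distribʳ (y - z) w (- x) ⟩
    w * (y - z) + - x * (y - z)                 ≈⟨ +-cong (distribˡ w y (- z)) (distribˡ (- x) y (- z)) ⟩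
    (w * y + w * - z) + (- x * y + - x * - z)   ≈⟨ +-cong (+-congˡ (sym (-‿distribʳ-* w z)))
                                                          (+-cong (sym (-‿distribˡ-* x y)) -x*-z≈xz) ⟩
    (w * y - w * z) + (- (x * y) + x * z)       ≈⟨ +-congˡ (+-comm _ _) ⟩
    (w * y - w * z) + (x * z - x * y)           ≈⟨ sym (-‿+-interchange _ _ _ _) ⟩
    (w * y + x * z) - (w * z + x * y)           ∎
    where
    -x*-z≈xz : - x * - z ≈ x * z
    -x*-z≈xz = trans (sym (-‿distribˡ-* x (- z)))
                 (trans (-‿cong (sym (-‿distribʳ-* x z))) (-‿involutive (x * z)))

  ℤ₂-homomorphism : ℤ₂-rawRing -Raw-AlmostCommutative⟶ fromCommutativeRing R
  ℤ₂-homomorphism = record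
    { ⟦_⟧ = ⟦_⟧ᶻ
    ; +-homo = λ { (a , b) (c , d) → begin
        ⟦ canonical (a ℕ.+ c) (b ℕ.+ d) ⟧ᶻ       ≡⟨ ⟦canonical⟧ (a ℕ.+ c) (b ℕ.+ d) ⟩
        ⟦ a ℕ.+ c , b ℕ.+ d ⟧ᶻ                   ≈⟨ ⟦⟧ᶻ-difference (a ℕ.+ c) (b ℕ.+ d) ⟩
        (a ℕ.+ c) × 1# - (b ℕ.+ d) × 1#          ≈⟨ +-cong (×-homo-+ 1# a c) (-‿cong (×-homo-+ 1# b d)) ⟩
        (a × 1# + c × 1#) - (b × 1# + d × 1#)    ≈⟨ -‿+-interchange _ _ _ _ ⟩
        (a × 1# - b × 1#) + (c × 1# - d × 1#)    ≈⟨ sym (+-cong (⟦⟧ᶻ-difference a b) (⟦⟧ᶻ-difference c d)) ⟩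
        ⟦ a , b ⟧ᶻ + ⟦ c , d ⟧ᶻ                  ∎ }
    ; *-homo = λ { (a , b) (c , d) → begin
        ⟦ canonical (a ℕ.* c ℕ.+ b ℕ.* d) (a ℕ.* d ℕ.+ b ℕ.* c) ⟧ᶻ
          ≡⟨ ⟦canonical⟧ (a ℕ.* c ℕ.+ b ℕ.* d) (a ℕ.* d ℕ.+ b ℕ.* c) ⟩
        ⟦ a ℕ.* c ℕ.+ b ℕ.* d , a ℕ.* d ℕ.+ b ℕ.* c ⟧ᶻ
          ≈⟨ ⟦⟧ᶻ-difference (a ℕ.* c ℕ.+ b ℕ.* d) (a ℕ.* d ℕ.+ b ℕ.* c) ⟩
        (a ℕ.* c ℕ.+ b ℕ.* d) × 1# - (a ℕ.* d ℕ.+ b ℕ.* c) × 1#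
          ≈⟨ +-cong (trans (×-homo-+ 1# (a ℕ.* c) (b ℕ.* d)) (+-cong (×1-homo-* a c) (×1-homo-* b d)))
                    (-‿cong (trans (×-homo-+ 1# (a ℕ.* d) (b ℕ.* c)) (+-cong (×1-homo-* a d) (×1-homo-* b c)))) ⟩
        ((a × 1#) * (c × 1#) + (b × 1#) * (d × 1#)) - ((a × 1#) * (d × 1#) + (b × 1#) * (c × 1#))
          ≈⟨ sym (-‿*-difference _ _ _ _) ⟩
        (a × 1# - b × 1#) * (c × 1# - d × 1#)
          ≈⟨ sym (*-cong (⟦⟧ᶻ-difference a b) (⟦⟧ᶻ-difference c d)) ⟩
        ⟦ a , b ⟧ᶻ * ⟦ c , d ⟧ᶻ ∎ }
    ; -‿homo = λ { (a , b) → begin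
        ⟦ b , a ⟧ᶻ                ≈⟨ ⟦⟧ᶻ-difference b a ⟩
        b × 1# - a × 1#           ≈⟨ +-comm _ _ ⟩
        - (a × 1#) + b × 1#       ≈⟨ +-congˡ (sym (-‿involutive _)) ⟩
        - (a × 1#) + - - (b × 1#) ≈⟨ -‿+-comm _ _ ⟩
        - (a × 1# - b × 1#)       ≈⟨ -‿cong (sym (⟦⟧ᶻ-difference a b)) ⟩
        - ⟦ a , b ⟧ᶻ              ∎ }
    ; 0-homo = refl
    ; 1-homo = refl
    }

  ℤ₂-≟ : WeaklyDecidable (Induced-equivalence ℤ₂-homomorphism)
  ℤ₂-≟ x y with ≡-dec ℕ._≟_ ℕ._≟_ x y
  ... | yes x≡y = just (reflexive (cong ⟦_⟧ᶻ x≡y))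
  ... | no _    = nothing

  open import Algebra.Solver.Ring ℤ₂-rawRing (fromCommutativeRing R) ℤ₂-homomorphism ℤ₂-≟ public
    using (solve; _:=_; con; _:+_; _:*_; :-_; _:-_)

module MatrixAlgebra {c ℓ} (K : Field c ℓ) where

  open import Data.Empty using (⊥-elim)
  open import Data.Fin using (Fin; zero; suc; _↑ˡ_; _↑ʳ_; punchIn; punchOut; _≟_)
  open import Data.Fin.Properties using (punchInᵢ≢i; punchIn-injective; punchIn-punchOut)
  open import Data.Nat as ℕ using (ℕ; zero; suc)
  open import Data.Product using (_×_; _,_; proj₁; proj₂)
  open import Data.Vec.Functional using (_++_; removeAt)
  open import Data.Vec.Functional.Properties using (lookup-++ˡ; lookup-++ʳ)
  open import Function using (_∘_)
  open import Level using (_⊔_)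
  open import Relation.Binary.PropositionalEquality as ≡ using (_≢_)
  open import Relation.Nullary using (yes; no)

  open Field K hiding (zero)
  open LinearAlgebra K
  open import Algebra.Properties.Semiring.Sum semiring
    using (sum; sum-cong-≋; sum-remove; ∑-distrib-+; ∑-comm; *-distribˡ-sum; *-distribʳ-sum)
  open import Algebra.Properties.Ring ring using (-0#≈0#; -‿+-comm; -‿distribˡ-*; -‿distribʳ-*)
  open import Relation.Binary.Reasoning.Setoid setoid
  open CommutativeRingSolver commutativeRing using (solve; _:=_; _:*_)

  sum-≈0 : ∀ {n} {f : Vec n} → f ≈ᵛ 0ᵛ → sum f ≈ 0#
  sum-≈0 {zero}  f≈0 = refl
  sum-≈0 {suc n} f≈0 = trans (+-cong (f≈0 zero) (sum-≈0 (f≈0 ∘ suc))) (+-identityˡ 0#)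

  -‿distrib-sum : ∀ {n} (f : Vec n) → sum (λ i → - f i) ≈ - sum f
  -‿distrib-sum {zero}  f = sym -0#≈0#
  -‿distrib-sum {suc n} f = trans (+-congˡ (-‿distrib-sum (f ∘ suc))) (-‿+-comm (f zero) (sum (f ∘ suc)))

  sum-single : ∀ {n} (f : Vec n) (j : Fin n) → (∀ i → i ≢ j → f i ≈ 0#) → sum f ≈ f j
  sum-single {suc n} f j others = begin
    sum f                  ≈⟨ sum-remove {i = j} f ⟩
    f j + sum (removeAt f j) ≈⟨ +-congˡ (sum-≈0 (λ i → others (punchIn j i) (punchInᵢ≢i j i))) ⟩
    f j + 0#               ≈⟨ +-identityʳ (f j) ⟩
    f j                    ∎

  sum-pair : ∀ {n} (f : Vec n) (a b : Fin n) → a ≢ b →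
             (∀ i → i ≢ a → i ≢ b → f i ≈ 0#) → sum f ≈ f a + f b
  sum-pair {suc n} f a b a≢b others = begin
    sum f                               ≈⟨ sum-remove {i = a} f ⟩
    f a + sum (removeAt f a)            ≈⟨ +-congˡ (sum-single (removeAt f a) (punchOut a≢b) others′) ⟩
    f a + f (punchIn a (punchOut a≢b))  ≈⟨ +-congˡ (reflexive (≡.cong f (punchIn-punchOut a≢b))) ⟩
    f a + f b                           ∎
    where
    others′ : ∀ i → i ≢ punchOut a≢b → f (punchIn a i) ≈ 0#
    others′ i i≢b′ = others (punchIn a i) (punchInᵢ≢i a i) λ aᵢ≡b →
      i≢b′ (punchIn-injective a i _ (≡.trans aᵢ≡b (≡.sym (punchIn-punchOut a≢b))))

  sum-splitAt : ∀ {p q} (f : Vec (p ℕ.+ q)) → sum f ≈ sum (λ t → f (t ↑ˡ q)) + sum (λ t → f (p ↑ʳ t))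
  sum-splitAt {zero}  f = sym (+-identityˡ _)
  sum-splitAt {suc p} {q} f = trans (+-congˡ (sum-splitAt {p} {q} (f ∘ suc)))
    (sym (+-assoc (f zero) (sum (λ t → f (suc (t ↑ˡ q)))) (sum (λ t → f (suc (p ↑ʳ t))))))

  δ : ∀ {n} → Fin n → Fin n → Carrier
  δ i j with i ≟ j
  ... | yes _ = 1#
  ... | no  _ = 0#

  δ-diag : ∀ {n} (i : Fin n) → δ i i ≈ 1#
  δ-diag i with i ≟ i
  ... | yes _   = refl
  ... | no  i≢i = ⊥-elim (i≢i ≡.refl)

  δ-off : ∀ {n} {i j : Fin n} → i ≢ j → δ i j ≈ 0#
  δ-off {i = i} {j} i≢j with i ≟ j
  ... | yes i≡j = ⊥-elim (i≢j i≡j)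
  ... | no  _   = refl

  sum-*δˡ : ∀ {n} (f : Vec n) (j : Fin n) → sum (λ i → f i * δ i j) ≈ f j
  sum-*δˡ f j = trans (sum-single (λ i → f i * δ i j) j (λ i i≢j → trans (*-congˡ (δ-off i≢j)) (zeroʳ (f i))))
                      (trans (*-congˡ (δ-diag j)) (*-identityʳ (f j)))

  sum-*δʳ : ∀ {n} (f : Vec n) (j : Fin n) → sum (λ i → f i * δ j i) ≈ f j
  sum-*δʳ f j = trans (sum-single (λ i → f i * δ j i) j (λ i i≢j → trans (*-congˡ (δ-off (i≢j ∘ ≡.sym))) (zeroʳ (f i))))
                      (trans (*-congˡ (δ-diag j)) (*-identityʳ (f j)))

  ·-cong : ∀ {m n} (M : Matrix m n) {x y : Vec n} → x ≈ᵛ y → (M · x) ≈ᵛ (M · y)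
  ·-cong {n = n} M x≈y i = sum-cong-≋ {n} (λ j → *-congˡ (x≈y j))

  ·-0ᵛ : ∀ {m n} (M : Matrix m n) {x : Vec n} → x ≈ᵛ 0ᵛ → (M · x) ≈ᵛ 0ᵛ
  ·-0ᵛ M x≈0 i = sum-≈0 (λ j → trans (*-congˡ (x≈0 j)) (zeroʳ _))

  ·-lincomb : ∀ {m n k} (M : Matrix m n) (b : Fin k → Carrier) (x : Fin k → Vec n) →
              (M · (λ t → sum (λ j → x j t * b j))) ≈ᵛ (λ i → sum (λ j → b j * (M · x j) i))
  ·-lincomb {m} {n} {k} M b x i = begin
    sum (λ t → M i t * sum (λ j → x j t * b j))     ≈⟨ sum-cong-≋ {n} (λ t → *-distribˡ-sum (M i t) (λ j → x j t * b j)) ⟩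
    sum (λ t → sum (λ j → M i t * (x j t * b j)))   ≈⟨ sum-cong-≋ {n} (λ t → sum-cong-≋ {k} (λ j → rearrange (M i t) (x j t) (b j))) ⟩
    sum (λ t → sum (λ j → b j * (M i t * x j t)))   ≈⟨ ∑-comm {n} {k} (λ t j → b j * (M i t * x j t)) ⟩
    sum (λ j → sum (λ t → b j * (M i t * x j t)))   ≈⟨ sum-cong-≋ {k} (λ j → sym (*-distribˡ-sum (b j) (λ t → M i t * x j t))) ⟩
    sum (λ j → b j * (M · x j) i)                   ∎
    where
    rearrange : ∀ u v w → u * (v * w) ≈ w * (u * v)
    rearrange = solve 3 (λ u v w → u :* (v :* w) := w :* (u :* v)) refl

  ⊗-· : ∀ {m n k} (P : Matrix m n) (Q : Matrix n k) (x : Vec k) → ((P ⊗ Q) · x) ≈ᵛ (P · (Q · x))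
  ⊗-· {m} {n} {k} P Q x i = begin
    sum (λ j → sum (λ t → P i t * Q t j) * x j)     ≈⟨ sum-cong-≋ {k} (λ j → *-distribʳ-sum (x j) (λ t → P i t * Q t j)) ⟩
    sum (λ j → sum (λ t → P i t * Q t j * x j))     ≈⟨ sum-cong-≋ {k} (λ j → sum-cong-≋ {n} (λ t → *-assoc _ _ _)) ⟩
    sum (λ j → sum (λ t → P i t * (Q t j * x j)))   ≈⟨ ∑-comm {k} {n} (λ j t → P i t * (Q t j * x j)) ⟩
    sum (λ t → sum (λ j → P i t * (Q t j * x j)))   ≈⟨ sum-cong-≋ {n} (λ t → sym (*-distribˡ-sum (P i t) (λ j → Q t j * x j))) ⟩
    (P · (Q · x)) i                                 ∎

  ·-congˡ : ∀ {m n} {P Q : Matrix m n} → P ≋ Q → ∀ x → (P · x) ≈ᵛ (Q · x)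
  ·-congˡ {n = n} P≋Q x i = sum-cong-≋ {n} (λ j → *-congʳ (P≋Q i j))

  ·-+ᵛ : ∀ {m n} (M : Matrix m n) (u w : Vec n) → (M · (u +ᵛ w)) ≈ᵛ ((M · u) +ᵛ (M · w))
  ·-+ᵛ {n = n} M u w i = trans (sum-cong-≋ {n} (λ j → distribˡ (M i j) (u j) (w j)))
                               (∑-distrib-+ (λ j → M i j * u j) (λ j → M i j * w j))

  ·-neg : ∀ {m n} (M : Matrix m n) (u : Vec n) → (M · (λ j → - u j)) ≈ᵛ (λ i → - (M · u) i)
  ·-neg {n = n} M u i = trans (sum-cong-≋ {n} (λ j → sym (-‿distribʳ-* (M i j) (u j))))
                              (-‿distrib-sum (λ j → M i j * u j))

  ⊖-· : ∀ {m n} (P Q : Matrix m n) (x : Vec n) → ((P ⊖ Q) · x) ≈ᵛ (λ i → (P · x) i - (Q · x) i)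
  ⊖-· {n = n} P Q x i = begin
    sum (λ j → (P i j - Q i j) * x j)            ≈⟨ sum-cong-≋ {n} (λ j → trans (distribʳ (x j) (P i j) (- Q i j))
                                                                              (+-congˡ (sym (-‿distribˡ-* (Q i j) (x j))))) ⟩
    sum (λ j → P i j * x j + - (Q i j * x j))    ≈⟨ ∑-distrib-+ (λ j → P i j * x j) (λ j → - (Q i j * x j)) ⟩
    (P · x) i + sum (λ j → - (Q i j * x j))      ≈⟨ +-congˡ (-‿distrib-sum (λ j → Q i j * x j)) ⟩
    (P · x) i - (Q · x) i                        ∎

  _∣_ : ∀ {m p q} → Matrix m p → Matrix m q → Matrix m (p ℕ.+ q)
  (P ∣ Q) i = P i ++ Q i

  ∣-· : ∀ {m p q} (P : Matrix m p) (Q : Matrix m q) (z : Vec (p ℕ.+ q)) →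
        ((P ∣ Q) · z) ≈ᵛ ((P · (λ t → z (t ↑ˡ q))) +ᵛ (Q · (λ t → z (p ↑ʳ t))))
  ∣-· {p = p} {q} P Q z i = trans (sum-splitAt {p} {q} _)
    (+-cong (sum-cong-≋ {p} (λ t → *-congʳ (reflexive (lookup-++ˡ (P i) (Q i) t))))
            (sum-cong-≋ {q} (λ t → *-congʳ (reflexive (lookup-++ʳ (P i) (Q i) t)))))

  ∣-·-++ : ∀ {m p q} (P : Matrix m p) (Q : Matrix m q) (x : Vec p) (y : Vec q) →
           ((P ∣ Q) · (x ++ y)) ≈ᵛ ((P · x) +ᵛ (Q · y))
  ∣-·-++ P Q x y i = trans (∣-· P Q (x ++ y) i)
    (+-cong (·-cong P (λ t → reflexive (lookup-++ˡ x y t)) i) (·-cong Q (λ t → reflexive (lookup-++ʳ x y t)) i))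

  ++-≈0ᵛ : ∀ {p q} (x : Vec p) (y : Vec q) → (x ++ y) ≈ᵛ 0ᵛ → (x ≈ᵛ 0ᵛ) × (y ≈ᵛ 0ᵛ)
  ++-≈0ᵛ x y x++y≈0 = (λ t → trans (reflexive (≡.sym (lookup-++ˡ x y t))) (x++y≈0 _))
                    , (λ t → trans (reflexive (≡.sym (lookup-++ʳ x y t))) (x++y≈0 _))

  Injective : ∀ {m n} → Matrix m n → Set (c ⊔ ℓ)
  Injective M = ∀ x → (M · x) ≈ᵛ 0ᵛ → x ≈ᵛ 0ᵛ

  ∣-injective : ∀ {m p q} (P : Matrix m p) (Q : Matrix m q) → Injective (P ∣ Q) →
                ∀ x y → ((P · x) +ᵛ (Q · y)) ≈ᵛ 0ᵛ → (x ≈ᵛ 0ᵛ) × (y ≈ᵛ 0ᵛ)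
  ∣-injective P Q inj x y Px+Qy≈0 = ++-≈0ᵛ x y (inj (x ++ y) (λ i → trans (∣-·-++ P Q x y i) (Px+Qy≈0 i)))

  ∣-injectiveˡ : ∀ {m p q} (P : Matrix m p) (Q : Matrix m q) → Injective (P ∣ Q) → Injective P
  ∣-injectiveˡ P Q inj x Px≈0 = proj₁ (∣-injective P Q inj x 0ᵛ (λ i → trans (+-cong (Px≈0 i) (·-0ᵛ Q (λ _ → refl) i)) (+-identityʳ 0#)))

  ∣-injectiveʳ : ∀ {m p q} (P : Matrix m p) (Q : Matrix m q) → Injective (P ∣ Q) → Injective Q
  ∣-injectiveʳ P Q inj y Qy≈0 = proj₂ (∣-injective P Q inj 0ᵛ y (λ i → trans (+-cong (·-0ᵛ P (λ _ → refl) i) (Qy≈0 i)) (+-identityʳ 0#)))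

  Im-∣ : ∀ {m p q} (P : Matrix m p) (Q : Matrix m q) → (Im P ⊕ₛ Im Q) ≐ Im (P ∣ Q)
  Im-∣ P Q = (λ { v (_ , _ , (x , Px≈a) , (y , Qy≈b) , v≈a+b) →
                   x ++ y , λ i → trans (∣-·-++ P Q x y i) (trans (+-cong (Px≈a i) (Qy≈b i)) (sym (v≈a+b i))) })
           , (λ { v (z , Pz≈v) → _ , _ , (_ , λ _ → refl) , (_ , λ _ → refl) ,
                   λ i → trans (sym (Pz≈v i)) (∣-· P Q z i) })

  ≐-trans : ∀ {n} {U V W : Subspace n} → U ≐ V → V ≐ W → U ≐ W
  ≐-trans (U⊆V , V⊆U) (V⊆W , W⊆V) = (λ v → V⊆W v ∘ U⊆V v) , (λ v → V⊆U v ∘ W⊆V v)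

  ⊕ₛ-congʳ : ∀ {n} {U U′ : Subspace n} (X : Subspace n) → U ≐ U′ → (U ⊕ₛ X) ≐ (U′ ⊕ₛ X)
  ⊕ₛ-congʳ X (U⊆U′ , U′⊆U) = (λ { v (a , b , Ua , Xb , v≈a+b) → a , b , U⊆U′ a Ua , Xb , v≈a+b })
                           , (λ { v (a , b , U′a , Xb , v≈a+b) → a , b , U′⊆U a U′a , Xb , v≈a+b })

module Determinant {c ℓ} (K : Field c ℓ) where

  open import Data.Empty using (⊥-elim)
  open import Data.Fin using (Fin; zero; suc; toℕ; fromℕ<; punchIn; punchOut; _≟_)
  open import Data.Fin.Properties
    using (toℕ-injective; toℕ-fromℕ<; toℕ<n; punchIn-punchOut; punchInᵢ≢i; punchIn-injective)
  open import Data.Nat as ℕ using (ℕ; zero; suc; _<_; _≤_; _∸_; z≤n; s≤s)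
  open import Data.Nat.Properties
    using (<-irrefl; <-trans; <-cmp; <-≤-trans; ≤-trans; ≤-reflexive; <⇒≤; ≮⇒≥; ≤∧≢⇒<; suc-injective;
           n<1+n; n≤1+n; m<n⇒m<1+n; m≤n⇒m≤1+n; m≤n+m; m∸n+n≡m; +-suc)
  open import Data.Product using (_×_; _,_)
  open import Data.Sum using (_⊎_; inj₁; inj₂)
  open import Data.Vec.Functional using (updateAt)
  open import Data.Vec.Functional.Properties using (updateAt-updates; updateAt-minimal)
  open import Function using (_∘_)
  open import Relation.Binary.Definitions using (tri<; tri≈; tri>)
  open import Relation.Binary.PropositionalEquality as ≡ using (_≡_; _≢_)
  open import Relation.Nullary using (yes; no)

  open Field K hiding (zero)
  open LinearAlgebra K
  open import Algebra.Properties.Semiring.Sum semiring using (sum; sum-cong-≋; ∑-distrib-+; *-distribˡ-sum)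
  open import Algebra.Properties.Ring ring using (-0#≈0#; -‿involutive)
  open import Relation.Binary.Reasoning.Setoid setoid
  open CommutativeRingSolver commutativeRing using (solve; _:=_; con; _:+_; _:*_; :-_)
  open MatrixAlgebra K

  sign : ℕ → Carrier
  sign zero    = 1#
  sign (suc n) = - sign n

  minor : ∀ {q} → Fin (suc q) → Matrix (suc q) (suc q) → Matrix q q
  minor i X r j = X (punchIn i r) (suc j)

  mutual
    det : ∀ {q} → Matrix q q → Carrier
    det {zero}  X = 1#
    det {suc q} X = sum (laplaceTerm X)

    laplaceTerm : ∀ {q} → Matrix (suc q) (suc q) → Fin (suc q) → Carrier
    laplaceTerm X i = (sign (toℕ i) * X i zero) * det (minor i X)

  det-cong : ∀ {q} {X Y : Matrix q q} → X ≋ Y → det X ≈ det Y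
  det-cong {zero}  X≋Y = refl
  det-cong {suc q} {X} {Y} X≋Y = sum-cong-≋ {x = laplaceTerm X} {y = laplaceTerm Y} (λ i →
    *-cong (*-congˡ (X≋Y i zero)) (det-cong (λ r j → X≋Y (punchIn i r) (suc j))))

  det-linear : ∀ {q} (X Y Z : Matrix q q) (r : Fin q) (α β : Carrier) →
               (∀ ρ → ρ ≢ r → X ρ ≈ᵛ Z ρ) → (∀ ρ → ρ ≢ r → Y ρ ≈ᵛ Z ρ) →
               (∀ j → Z r j ≈ α * X r j + β * Y r j) → det Z ≈ α * det X + β * det Y
  det-linear {suc q} X Y Z r α β X≈Z Y≈Z Zr≈ = begin
    sum (laplaceTerm Z)
      ≈⟨ sum-cong-≋ {x = laplaceTerm Z} {y = λ i → α * laplaceTerm X i + β * laplaceTerm Y i} split ⟩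
    sum (λ i → α * laplaceTerm X i + β * laplaceTerm Y i)
      ≈⟨ ∑-distrib-+ (λ i → α * laplaceTerm X i) (λ i → β * laplaceTerm Y i) ⟩
    sum (λ i → α * laplaceTerm X i) + sum (λ i → β * laplaceTerm Y i)
      ≈⟨ sym (+-cong (*-distribˡ-sum α (laplaceTerm X)) (*-distribˡ-sum β (laplaceTerm Y))) ⟩
    α * sum (laplaceTerm X) + β * sum (laplaceTerm Y)
      ∎
    where
    distrib₂ : ∀ s a b x y d → (s * (a * x + b * y)) * d ≈ a * ((s * x) * d) + b * ((s * y) * d)
    distrib₂ = solve 6 (λ s a b x y d → (s :* (a :* x :+ b :* y)) :* d := a :* ((s :* x) :* d) :+ b :* ((s :* y) :* d)) refl
    distrib₁ : ∀ s a b x y → s * (a * x + b * y) ≈ a * (s * x) + b * (s * y)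
    distrib₁ = solve 5 (λ s a b x y → s :* (a :* x :+ b :* y) := a :* (s :* x) :+ b :* (s :* y)) refl
    split : ∀ i → laplaceTerm Z i ≈ α * laplaceTerm X i + β * laplaceTerm Y i
    split i with i ≟ r
    ... | yes ≡.refl = begin
      (sign (toℕ i) * Z i zero) * det (minor i Z)   ≈⟨ *-congʳ (*-congˡ (Zr≈ zero)) ⟩
      (sign (toℕ i) * (α * X i zero + β * Y i zero)) * det (minor i Z)
        ≈⟨ distrib₂ _ _ _ _ _ _ ⟩
      α * ((sign (toℕ i) * X i zero) * det (minor i Z)) + β * ((sign (toℕ i) * Y i zero) * det (minor i Z))
        ≈⟨ +-cong (*-congˡ (*-congˡ (sym (det-cong (λ ρ j → X≈Z (punchIn i ρ) (punchInᵢ≢i i ρ) (suc j))))))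
                  (*-congˡ (*-congˡ (sym (det-cong (λ ρ j → Y≈Z (punchIn i ρ) (punchInᵢ≢i i ρ) (suc j)))))) ⟩
      α * laplaceTerm X i + β * laplaceTerm Y i                   ∎
    ... | no i≢r = begin
      (sign (toℕ i) * Z i zero) * det (minor i Z)   ≈⟨ *-congˡ minor-linear ⟩
      (sign (toℕ i) * Z i zero) * (α * det (minor i X) + β * det (minor i Y))
        ≈⟨ distrib₁ _ _ _ _ _ ⟩
      α * ((sign (toℕ i) * Z i zero) * det (minor i X)) + β * ((sign (toℕ i) * Z i zero) * det (minor i Y))
        ≈⟨ +-cong (*-congˡ (*-congʳ (*-congˡ (sym (X≈Z i i≢r zero)))))
                  (*-congˡ (*-congʳ (*-congˡ (sym (Y≈Z i i≢r zero))))) ⟩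
      α * laplaceTerm X i + β * laplaceTerm Y i                   ∎
      where
      r′ : Fin q
      r′ = punchOut i≢r
      punchIn-r′ : punchIn i r′ ≡ r
      punchIn-r′ = punchIn-punchOut i≢r
      off-r′ : ∀ ρ → ρ ≢ r′ → punchIn i ρ ≢ r
      off-r′ ρ ρ≢r′ eq = ρ≢r′ (punchIn-injective i ρ r′ (≡.trans eq (≡.sym punchIn-r′)))
      minor-linear : det (minor i Z) ≈ α * det (minor i X) + β * det (minor i Y)
      minor-linear = det-linear (minor i X) (minor i Y) (minor i Z) r′ α β
        (λ ρ ρ≢r′ j → X≈Z (punchIn i ρ) (off-r′ ρ ρ≢r′) (suc j))
        (λ ρ ρ≢r′ j → Y≈Z (punchIn i ρ) (off-r′ ρ ρ≢r′) (suc j))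
        (λ j → ≡.subst (λ t → Z t (suc j) ≈ α * X t (suc j) + β * Y t (suc j)) (≡.sym punchIn-r′) (Zr≈ (suc j)))

  toℕ-punchIn-< : ∀ {n} (i : Fin (suc n)) (j : Fin n) → toℕ j < toℕ i → toℕ (punchIn i j) ≡ toℕ j
  toℕ-punchIn-< zero    j       ()
  toℕ-punchIn-< (suc i) zero    _         = ≡.refl
  toℕ-punchIn-< (suc i) (suc j) (s≤s j<i) = ≡.cong suc (toℕ-punchIn-< i j j<i)

  toℕ-punchIn-≥ : ∀ {n} (i : Fin (suc n)) (j : Fin n) → toℕ i ≤ toℕ j → toℕ (punchIn i j) ≡ suc (toℕ j)
  toℕ-punchIn-≥ zero    j       _         = ≡.refl
  toℕ-punchIn-≥ (suc i) zero    ()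
  toℕ-punchIn-≥ (suc i) (suc j) (s≤s i≤j) = ≡.cong suc (toℕ-punchIn-≥ i j i≤j)

  toℕ-punchIn : ∀ {n} (i : Fin (suc n)) (j : Fin n) →
                (toℕ j < toℕ i × toℕ (punchIn i j) ≡ toℕ j) ⊎ (toℕ i ≤ toℕ j × toℕ (punchIn i j) ≡ suc (toℕ j))
  toℕ-punchIn i j with toℕ j ℕ.<? toℕ i
  ... | yes j<i = inj₁ (j<i , toℕ-punchIn-< i j j<i)
  ... | no  j≮i = inj₂ (≮⇒≥ j≮i , toℕ-punchIn-≥ i j (≮⇒≥ j≮i))

  punchIn-adjacent : ∀ {n} (i : Fin (suc n)) (a b : Fin n) →
                     toℕ (punchIn i b) ≡ suc (toℕ (punchIn i a)) → toℕ b ≡ suc (toℕ a)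
  punchIn-adjacent i a b adj with toℕ-punchIn i a | toℕ-punchIn i b
  ... | inj₁ (_ , ia) | inj₁ (_ , ib) = ≡.trans (≡.sym ib) (≡.trans adj (≡.cong suc ia))
  ... | inj₂ (_ , ia) | inj₂ (_ , ib) = suc-injective (≡.trans (≡.sym ib) (≡.trans adj (≡.cong suc ia)))
  ... | inj₁ (a<i , ia) | inj₂ (i≤b , ib) =
    ⊥-elim (<-irrefl ≡.refl (<-≤-trans a<i (≡.subst (toℕ i ≤_) (suc-injective (≡.trans (≡.sym ib) (≡.trans adj (≡.cong suc ia)))) i≤b)))
  ... | inj₂ (i≤a , ia) | inj₁ (b<i , ib) =
    ⊥-elim (<-irrefl ≡.refl (<-≤-trans b<i (≤-trans i≤a (≡.subst (toℕ a ≤_) (≡.sym b≡2+a) (m≤n⇒m≤1+n (n≤1+n _))))))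
    where
    b≡2+a : toℕ b ≡ suc (suc (toℕ a))
    b≡2+a = ≡.trans (≡.sym ib) (≡.trans adj (≡.cong suc ia))

  toℕ-≡⇒rows-≈ : ∀ {m n} (X : Matrix m n) {u v : Fin m} → toℕ u ≡ toℕ v → X u ≈ᵛ X v
  toℕ-≡⇒rows-≈ X u≡v j with toℕ-injective u≡v
  ... | ≡.refl = refl

  det-adjacent-rows : ∀ {q} (X : Matrix q q) (a b : Fin q) → toℕ b ≡ suc (toℕ a) → X a ≈ᵛ X b → det X ≈ 0#
  det-adjacent-rows {suc q} X a b b≡1+a Xa≈Xb = begin
    sum (laplaceTerm X)                 ≈⟨ sum-pair (laplaceTerm X) a b a≢b others ⟩
    laplaceTerm X a + laplaceTerm X b   ≈⟨ +-congˡ (*-cong (*-cong (reflexive (≡.cong sign b≡1+a)) (sym (Xa≈Xb zero)))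
                                                          (sym (det-cong minors-≈))) ⟩
    (sign (toℕ a) * X a zero) * det (minor a X) + (- sign (toℕ a) * X a zero) * det (minor a X)
                                        ≈⟨ cancel _ _ _ ⟩
    0#                                  ∎
    where
    cancel : ∀ s x d → (s * x) * d + (- s * x) * d ≈ 0#
    cancel = solve 3 (λ s x d → (s :* x) :* d :+ (:- s :* x) :* d := con (0 , 0)) refl
    a≢b : a ≢ b
    a≢b a≡b = <-irrefl (≡.trans (≡.cong toℕ a≡b) b≡1+a) (n<1+n (toℕ a))
    others : ∀ i → i ≢ a → i ≢ b → laplaceTerm X i ≈ 0#
    others i i≢a i≢b = trans (*-congˡ minor≈0) (zeroʳ _)
      where
      a′ b′ : Fin q
      a′ = punchOut i≢a
      b′ = punchOut i≢b
      minor≈0 : det (minor i X) ≈ 0#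
      minor≈0 = det-adjacent-rows (minor i X) a′ b′
        (punchIn-adjacent i a′ b′ (≡.subst₂ (λ u v → toℕ v ≡ suc (toℕ u)) (≡.sym (punchIn-punchOut i≢a)) (≡.sym (punchIn-punchOut i≢b)) b≡1+a))
        (λ j → trans (toℕ-≡⇒rows-≈ X (≡.cong toℕ (punchIn-punchOut i≢a)) (suc j))
                 (trans (Xa≈Xb (suc j)) (toℕ-≡⇒rows-≈ X (≡.cong toℕ (≡.sym (punchIn-punchOut i≢b))) (suc j))))
    <suc-a⇒<b : ∀ {t} → t < suc (toℕ a) → t < toℕ b
    <suc-a⇒<b = ≡.subst (_ <_) (≡.sym b≡1+a)
    minors-≈ : minor a X ≋ minor b X
    minors-≈ ρ j with <-cmp (toℕ ρ) (toℕ a)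
    ... | tri< ρ<a _ _ = toℕ-≡⇒rows-≈ X
            (≡.trans (toℕ-punchIn-< a ρ ρ<a) (≡.sym (toℕ-punchIn-< b ρ (<suc-a⇒<b (m<n⇒m<1+n ρ<a))))) (suc j)
    ... | tri≈ _ ρ≡a _ = trans (toℕ-≡⇒rows-≈ X a↦b (suc j)) (trans (sym (Xa≈Xb (suc j))) (toℕ-≡⇒rows-≈ X a↤b (suc j)))
      where
      a↦b : toℕ (punchIn a ρ) ≡ toℕ b
      a↦b = ≡.trans (toℕ-punchIn-≥ a ρ (≤-reflexive (≡.sym ρ≡a))) (≡.trans (≡.cong suc ρ≡a) (≡.sym b≡1+a))
      a↤b : toℕ a ≡ toℕ (punchIn b ρ)
      a↤b = ≡.trans (≡.sym ρ≡a) (≡.sym (toℕ-punchIn-< b ρ (<suc-a⇒<b (≤-reflexive (≡.cong suc ρ≡a)))))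
    ... | tri> _ _ ρ>a = toℕ-≡⇒rows-≈ X
            (≡.trans (toℕ-punchIn-≥ a ρ (<⇒≤ ρ>a)) (≡.sym (toℕ-punchIn-≥ b ρ (≡.subst (_≤ toℕ ρ) (≡.sym b≡1+a) ρ>a)))) (suc j)

  det-additive : ∀ {q} (X Y Z : Matrix q q) (r : Fin q) →
                 (∀ ρ → ρ ≢ r → X ρ ≈ᵛ Z ρ) → (∀ ρ → ρ ≢ r → Y ρ ≈ᵛ Z ρ) →
                 (∀ j → Z r j ≈ X r j + Y r j) → det Z ≈ det X + det Y
  det-additive X Y Z r X≈Z Y≈Z Zr≈ =
    trans (det-linear X Y Z r 1# 1# X≈Z Y≈Z (λ j → trans (Zr≈ j) (sym (+-cong (*-identityˡ _) (*-identityˡ _)))))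
          (+-cong (*-identityˡ _) (*-identityˡ _))

  setRow : ∀ {q} → Matrix q q → Fin q → Vec q → Matrix q q
  setRow X r u = updateAt X r (λ _ → u)

  setRow-here : ∀ {q} (X : Matrix q q) r u → setRow X r u r ≈ᵛ u
  setRow-here X r u j = reflexive (≡.cong (λ w → w j) (updateAt-updates r X))

  setRow-there : ∀ {q} (X : Matrix q q) r u ρ → ρ ≢ r → setRow X r u ρ ≈ᵛ X ρ
  setRow-there X r u ρ ρ≢r j = reflexive (≡.cong (λ w → w j) (updateAt-minimal ρ r X ρ≢r))

  module RowPair {q} (X : Matrix q q) (m b : Fin q) (m≢b : m ≢ b) where

    withRows : Vec q → Vec q → Matrix q q
    withRows u v = setRow (setRow X b v) m u

    withRows-m : ∀ u v → withRows u v m ≈ᵛ u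
    withRows-m u v = setRow-here (setRow X b v) m u

    withRows-b : ∀ u v → withRows u v b ≈ᵛ v
    withRows-b u v j = trans (setRow-there (setRow X b v) m u b (m≢b ∘ ≡.sym) j) (setRow-here X b v j)

    withRows-off-m : ∀ u u′ v ρ → ρ ≢ m → withRows u v ρ ≈ᵛ withRows u′ v ρ
    withRows-off-m u u′ v ρ ρ≢m j = trans (setRow-there _ m u ρ ρ≢m j) (sym (setRow-there _ m u′ ρ ρ≢m j))

    withRows-off-b : ∀ u v v′ ρ → ρ ≢ b → withRows u v ρ ≈ᵛ withRows u v′ ρ
    withRows-off-b u v v′ ρ ρ≢b with ρ ≟ m
    ... | yes ≡.refl = λ j → trans (withRows-m u v j) (sym (withRows-m u v′ j))
    ... | no  ρ≢m    = λ j → trans (setRow-there _ m u ρ ρ≢m j)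
                               (trans (setRow-there X b v ρ ρ≢b j)
                                 (sym (trans (setRow-there _ m u ρ ρ≢m j) (setRow-there X b v′ ρ ρ≢b j))))

    withRows-X : withRows (X m) (X b) ≋ X
    withRows-X ρ with ρ ≟ m | ρ ≟ b
    ... | yes ≡.refl | _          = withRows-m (X m) (X b)
    ... | no  _      | yes ≡.refl = withRows-b (X m) (X b)
    ... | no  ρ≢m    | no ρ≢b     = λ j → trans (setRow-there _ m _ ρ ρ≢m j) (setRow-there X b _ ρ ρ≢b j)

    det-withRows-additiveˡ : ∀ u u′ v → det (withRows (u +ᵛ u′) v) ≈ det (withRows u v) + det (withRows u′ v)
    det-withRows-additiveˡ u u′ v = det-additive _ _ _ m
      (λ ρ ρ≢m → withRows-off-m _ _ v ρ ρ≢m) (λ ρ ρ≢m → withRows-off-m _ _ v ρ ρ≢m)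
      (λ j → trans (withRows-m _ v j) (sym (+-cong (withRows-m u v j) (withRows-m u′ v j))))

    det-withRows-additiveʳ : ∀ u v v′ → det (withRows u (v +ᵛ v′)) ≈ det (withRows u v) + det (withRows u v′)
    det-withRows-additiveʳ u v v′ = det-additive _ _ _ b
      (λ ρ ρ≢b → withRows-off-b u _ _ ρ ρ≢b) (λ ρ ρ≢b → withRows-off-b u _ _ ρ ρ≢b)
      (λ j → trans (withRows-b u _ j) (sym (+-cong (withRows-b u v j) (withRows-b u v′ j))))

    -- Expanding det (withRows s s) with s = X m + X b by additivity in both rows leaves
    -- det X + det (withRows (X b) (X m)), the other two terms having equal rows m and b.
    det-swap : (∀ Z → Z m ≈ᵛ Z b → det Z ≈ 0#) → det (withRows (X b) (X m)) ≈ - det X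
    det-swap alternating = begin
      det (withRows (X b) (X m))                        ≈⟨ sym (+-identityʳ _) ⟩
      det (withRows (X b) (X m)) + 0#                   ≈⟨ +-congˡ (sym (-‿inverseʳ (det X))) ⟩
      det (withRows (X b) (X m)) + (det X - det X)      ≈⟨ sym (+-assoc _ _ _) ⟩
      (det (withRows (X b) (X m)) + det X) - det X      ≈⟨ +-congʳ (trans (+-comm _ _) sum≈0) ⟩
      0# - det X                                        ≈⟨ +-identityˡ _ ⟩
      - det X                                           ∎
      where
      s = X m +ᵛ X b
      diagonal≈0 : ∀ u → det (withRows u u) ≈ 0#
      diagonal≈0 u = alternating (withRows u u) (λ j → trans (withRows-m u u j) (sym (withRows-b u u j)))
      sum≈0 : det X + det (withRows (X b) (X m)) ≈ 0#
      sum≈0 = begin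
        det X + det (withRows (X b) (X m))
          ≈⟨ sym (+-cong (trans (+-congʳ (diagonal≈0 (X m))) (trans (+-identityˡ _) (det-cong withRows-X)))
                         (trans (+-congˡ (diagonal≈0 (X b))) (+-identityʳ _))) ⟩
        (det (withRows (X m) (X m)) + det (withRows (X m) (X b))) + (det (withRows (X b) (X m)) + det (withRows (X b) (X b)))
          ≈⟨ sym (+-cong (det-withRows-additiveʳ (X m) (X m) (X b)) (det-withRows-additiveʳ (X b) (X m) (X b))) ⟩
        det (withRows (X m) s) + det (withRows (X b) s)  ≈⟨ sym (det-withRows-additiveˡ (X m) (X b) s) ⟩
        det (withRows s s)                               ≈⟨ diagonal≈0 s ⟩
        0#                                               ∎

  det-equal-rows-at : ∀ d {q} (X : Matrix q q) (a b : Fin q) → toℕ b ≡ suc (d ℕ.+ toℕ a) →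
                      X a ≈ᵛ X b → det X ≈ 0#
  det-equal-rows-at zero    X a b b≡1+a Xa≈Xb = det-adjacent-rows X a b b≡1+a Xa≈Xb
  det-equal-rows-at (suc d) {q} X a b b≡2+d+a Xa≈Xb = begin
    det X           ≈⟨ sym (-‿involutive _) ⟩
    - - det X       ≈⟨ -‿cong (trans (sym (RowPair.det-swap X m b m≢b (λ Z → det-adjacent-rows Z m b b≡1+m))) swapped≈0) ⟩
    - 0#            ≈⟨ -0#≈0# ⟩
    0#              ∎
    where
    m<q : suc (d ℕ.+ toℕ a) < q
    m<q = <-trans (n<1+n _) (≡.subst (_< q) b≡2+d+a (toℕ<n b))
    m : Fin q
    m = fromℕ< m<q
    m≡1+d+a : toℕ m ≡ suc (d ℕ.+ toℕ a)
    m≡1+d+a = toℕ-fromℕ< m<q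
    b≡1+m : toℕ b ≡ suc (toℕ m)
    b≡1+m = ≡.trans b≡2+d+a (≡.cong suc (≡.sym m≡1+d+a))
    m≢b : m ≢ b
    m≢b m≡b = <-irrefl (≡.trans (≡.cong toℕ m≡b) b≡1+m) (n<1+n (toℕ m))
    a≢m : a ≢ m
    a≢m a≡m = <-irrefl (≡.trans (≡.cong toℕ a≡m) m≡1+d+a) (s≤s (m≤n+m (toℕ a) d))
    a≢b : a ≢ b
    a≢b a≡b = <-irrefl (≡.trans (≡.cong toℕ a≡b) b≡2+d+a) (s≤s (m≤n+m (toℕ a) (suc d)))
    swapped≈0 : det (RowPair.withRows X m b m≢b (X b) (X m)) ≈ 0#
    swapped≈0 = det-equal-rows-at d _ a m m≡1+d+a (λ j →
      trans (setRow-there _ m _ a a≢m j)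
        (trans (setRow-there X b _ a a≢b j) (trans (Xa≈Xb j) (sym (setRow-here _ m (X b) j)))))

  m<n⇒n≡1+[n∸1+m]+m : ∀ {m n} → m < n → n ≡ suc ((n ∸ suc m) ℕ.+ m)
  m<n⇒n≡1+[n∸1+m]+m {m} {n} m<n = ≡.sym (≡.trans (≡.sym (+-suc (n ∸ suc m) m)) (m∸n+n≡m m<n))

  det-equal-rows : ∀ {q} (X : Matrix q q) (a b : Fin q) → a ≢ b → X a ≈ᵛ X b → det X ≈ 0#
  det-equal-rows X a b a≢b Xa≈Xb with <-cmp (toℕ a) (toℕ b)
  ... | tri< a<b _ _ = det-equal-rows-at (toℕ b ∸ suc (toℕ a)) X a b (m<n⇒n≡1+[n∸1+m]+m a<b) Xa≈Xb
  ... | tri≈ _ a≡b _ = ⊥-elim (a≢b (toℕ-injective a≡b))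
  ... | tri> _ _ b<a = det-equal-rows-at (toℕ a ∸ suc (toℕ b)) X b a (m<n⇒n≡1+[n∸1+m]+m b<a) (λ j → sym (Xa≈Xb j))

  det-zero-row : ∀ {q} (X : Matrix q q) (r : Fin q) → X r ≈ᵛ 0ᵛ → det X ≈ 0#
  det-zero-row X r Xr≈0 = trans
    (det-linear X X X r 0# 0# (λ _ _ _ → refl) (λ _ _ _ → refl)
      (λ j → trans (Xr≈0 j) (sym (trans (+-cong (zeroˡ _) (zeroˡ _)) (+-identityʳ 0#)))))
    (trans (+-cong (zeroˡ _) (zeroˡ _)) (+-identityʳ 0#))

  det-add-row : ∀ {q} (X Z : Matrix q q) (r s : Fin q) (λ′ : Carrier) → r ≢ s →
                (∀ ρ → ρ ≢ r → Z ρ ≈ᵛ X ρ) → (∀ j → Z r j ≈ X r j + λ′ * X s j) → det Z ≈ det X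
  det-add-row X Z r s λ′ r≢s Z≈X Zr≈ = begin
    det Z                    ≈⟨ det-linear X Y Z r 1# λ′ (λ ρ ρ≢r j → sym (Z≈X ρ ρ≢r j))
                                  (λ ρ ρ≢r j → trans (setRow-there X r (X s) ρ ρ≢r j) (sym (Z≈X ρ ρ≢r j)))
                                  (λ j → trans (Zr≈ j) (+-cong (sym (*-identityˡ _)) (*-congˡ (sym (setRow-here X r (X s) j))))) ⟩
    1# * det X + λ′ * det Y  ≈⟨ +-cong (*-identityˡ _) (trans (*-congˡ Y≈0) (zeroʳ λ′)) ⟩
    det X + 0#               ≈⟨ +-identityʳ _ ⟩
    det X                    ∎
    where
    Y = setRow X r (X s)
    Y≈0 : det Y ≈ 0#
    Y≈0 = det-equal-rows Y r s r≢s (λ j → trans (setRow-here X r (X s) j) (sym (setRow-there X r (X s) s (r≢s ∘ ≡.sym) j)))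

  addMultiplesOfRow : ∀ {q} → Matrix q q → Fin q → Vec q → Matrix q q
  addMultiplesOfRow X s μ ρ j = X ρ j + μ ρ * X s j

  det-addMultiplesOfRow-upTo : ∀ k {q} (X : Matrix q q) (s : Fin q) (μ : Vec q) → μ s ≈ 0# →
                               (∀ ρ → k ≤ toℕ ρ → μ ρ ≈ 0#) → det (addMultiplesOfRow X s μ) ≈ det X
  det-addMultiplesOfRow-upTo zero X s μ μs≈0 μ≈0 =
    det-cong (λ ρ j → trans (+-congˡ (trans (*-congʳ (μ≈0 ρ z≤n)) (zeroˡ _))) (+-identityʳ _))
  det-addMultiplesOfRow-upTo (suc k) {q} X s μ μs≈0 μ≈0 with k ℕ.<? q
  ... | no k≮q = det-addMultiplesOfRow-upTo k X s μ μs≈0 (λ ρ k≤ρ → μ≈0 ρ (≤∧≢⇒< k≤ρ λ k≡ρ →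
                   k≮q (≡.subst (_< q) (≡.sym k≡ρ) (toℕ<n ρ))))
  ... | yes k<q = trans det-step (det-addMultiplesOfRow-upTo k X s μ′ μ′s≈0 μ′≈0)
    where
    ρₖ : Fin q
    ρₖ = fromℕ< k<q
    μ′ : Vec q
    μ′ = updateAt μ ρₖ (λ _ → 0#)
    μ′-ρₖ : μ′ ρₖ ≈ 0#
    μ′-ρₖ = reflexive (updateAt-updates ρₖ μ)
    μ′-there : ∀ ρ → ρ ≢ ρₖ → μ′ ρ ≡ μ ρ
    μ′-there ρ ρ≢ρₖ = updateAt-minimal ρ ρₖ μ ρ≢ρₖ
    μ′s≈0 : μ′ s ≈ 0#
    μ′s≈0 with s ≟ ρₖ
    ... | yes ≡.refl = μ′-ρₖ
    ... | no  s≢ρₖ   = trans (reflexive (μ′-there s s≢ρₖ)) μs≈0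
    μ′≈0 : ∀ ρ → k ≤ toℕ ρ → μ′ ρ ≈ 0#
    μ′≈0 ρ k≤ρ with ρ ≟ ρₖ
    ... | yes ≡.refl = μ′-ρₖ
    ... | no  ρ≢ρₖ   = trans (reflexive (μ′-there ρ ρ≢ρₖ)) (μ≈0 ρ (≤∧≢⇒< k≤ρ λ k≡ρ →
                         ρ≢ρₖ (toℕ-injective (≡.trans (≡.sym k≡ρ) (≡.sym (toℕ-fromℕ< k<q))))))
    X′ = addMultiplesOfRow X s μ′
    unchanged : ∀ ρ → ρ ≢ ρₖ → addMultiplesOfRow X s μ ρ ≈ᵛ X′ ρ
    unchanged ρ ρ≢ρₖ j = +-congˡ (*-congʳ (reflexive (≡.sym (μ′-there ρ ρ≢ρₖ))))
    X′-ρₖ : X′ ρₖ ≈ᵛ X ρₖ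
    X′-ρₖ j = trans (+-congˡ (trans (*-congʳ μ′-ρₖ) (zeroˡ _))) (+-identityʳ _)
    det-step : det (addMultiplesOfRow X s μ) ≈ det X′
    det-step with ρₖ ≟ s
    ... | yes ≡.refl = det-cong (λ ρ j → +-congˡ (*-congʳ (sym (μ′≈ ρ))))
      where
      μ′≈ : ∀ ρ → μ′ ρ ≈ μ ρ
      μ′≈ ρ with ρ ≟ ρₖ
      ... | yes ≡.refl = trans μ′-ρₖ (sym μs≈0)
      ... | no  ρ≢ρₖ   = reflexive (μ′-there ρ ρ≢ρₖ)
    ... | no ρₖ≢s = det-add-row X′ (addMultiplesOfRow X s μ) ρₖ s (μ ρₖ) ρₖ≢s unchanged
        (λ j → +-cong (sym (X′-ρₖ j)) (*-congˡ (sym (X′-s j))))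
      where
      X′-s : X′ s ≈ᵛ X s
      X′-s j = trans (+-congˡ (trans (*-congʳ μ′s≈0) (zeroˡ _))) (+-identityʳ _)

  det-addMultiplesOfRow : ∀ {q} (X : Matrix q q) (s : Fin q) (μ : Vec q) → μ s ≈ 0# →
                          det (addMultiplesOfRow X s μ) ≈ det X
  det-addMultiplesOfRow {q} X s μ μs≈0 =
    det-addMultiplesOfRow-upTo q X s μ μs≈0 (λ ρ q≤ρ → ⊥-elim (<-irrefl ≡.refl (<-≤-trans (toℕ<n ρ) q≤ρ)))

module Invertibility {c ℓ} (K : Field c ℓ) where

  open import Data.Empty using (⊥; ⊥-elim)
  open import Data.Fin using (Fin; zero; suc; toℕ; fromℕ<; inject≤; punchIn; punchOut; _≟_)
  open import Data.Fin.Properties using (punchIn-punchOut; toℕ<n; toℕ-injective; toℕ-fromℕ<; toℕ-inject≤)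
  open import Data.Nat as ℕ using (ℕ; zero; suc; _≤_; _<_)
  open import Data.Nat.Properties using (≰⇒>; <⇒≤; <-irrefl)
  open import Data.Product using (Σ; ∃; _×_; _,_; proj₁; proj₂)
  open import Data.Sum using (_⊎_; inj₁; inj₂)
  open import Data.Vec.Functional using (_∷_; updateAt)
  open import Data.Vec.Functional.Properties using (updateAt-updates; updateAt-minimal)
  open import Function using (_∘_)
  open import Relation.Binary.PropositionalEquality as ≡ using (_≡_; _≢_)
  open import Relation.Nullary using (¬_; yes; no)
  open import Relation.Nullary.Decidable using (¬¬-excluded-middle)

  open Field K hiding (zero)
  open LinearAlgebra K
  open import Algebra.Properties.Semiring.Sum semiring using (sum; sum-cong-≋; ∑-distrib-+; ∑-comm; *-distribˡ-sum)
  open import Algebra.Properties.Ring ring using (-0#≈0#)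
  open import Relation.Binary.Reasoning.Setoid setoid
  open CommutativeRingSolver commutativeRing using (solve; _:=_; con; _:+_; _:*_; :-_; _:-_)
  open MatrixAlgebra K
  open Determinant K

  det-∷-lincomb : ∀ {q m} (a : Fin m → Carrier) (U : Fin m → Vec (suc q)) (B : Matrix q (suc q)) →
                  det ((λ j → sum (λ t → a t * U t j)) ∷ B) ≈ sum (λ t → a t * det (U t ∷ B))
  det-∷-lincomb {m = zero} a U B = det-zero-row (0ᵛ ∷ B) zero (λ _ → refl)
  det-∷-lincomb {q} {suc m} a U B = begin
    det ((λ j → sum (λ t → a t * U t j)) ∷ B)
      ≈⟨ det-linear (U zero ∷ B) ((λ j → sum (λ t → a (suc t) * U (suc t) j)) ∷ B) _ zero (a zero) 1#
           rest rest (λ j → +-congˡ (sym (*-identityˡ _))) ⟩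
    a zero * det (U zero ∷ B) + 1# * det ((λ j → sum (λ t → a (suc t) * U (suc t) j)) ∷ B)
      ≈⟨ +-congˡ (trans (*-identityˡ _) (det-∷-lincomb (a ∘ suc) (U ∘ suc) B)) ⟩
    sum (λ t → a t * det (U t ∷ B))                                  ∎
    where
    rest : ∀ {u v : Vec (suc q)} ρ → ρ ≢ zero → (u ∷ B) ρ ≈ᵛ (v ∷ B) ρ
    rest zero    ρ≢0 = ⊥-elim (ρ≢0 ≡.refl)
    rest (suc ρ) _   = λ _ → refl

  cofactor : ∀ {q} → Matrix (suc q) (suc q) → Fin (suc q) → Fin (suc q) → Carrier
  cofactor X j r = det (δ j ∷ (X ∘ punchIn r))

  adjugate : ∀ {q} → Matrix (suc q) (suc q) → Vec (suc q) → Vec (suc q)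
  adjugate X y j = sum (λ r → (sign (toℕ r) * cofactor X j r) * y r)

  -- Expand along the first column the matrix with rows (y i , X i) and (y r , X r) for
  -- every r; it has two equal rows, so its determinant vanishes.
  cramer : ∀ {q} (X : Matrix (suc q) (suc q)) (y : Vec (suc q)) → (X · adjugate X y) ≈ᵛ (λ i → det X * y i)
  cramer {q} X y i = begin
    sum (λ j → X i j * adjugate X y j)
      ≈⟨ sum-cong-≋ {suc q} (λ j → *-distribˡ-sum (X i j) (λ r → (sign (toℕ r) * cofactor X j r) * y r)) ⟩
    sum (λ j → sum (λ r → X i j * ((sign (toℕ r) * cofactor X j r) * y r)))
      ≈⟨ ∑-comm {suc q} {suc q} (λ j r → X i j * ((sign (toℕ r) * cofactor X j r) * y r)) ⟩
    sum (λ r → sum (λ j → X i j * ((sign (toℕ r) * cofactor X j r) * y r)))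
      ≈⟨ sum-cong-≋ {suc q} (λ r → trans (sum-cong-≋ {suc q} (λ j → regroup (X i j) (sign (toℕ r)) (cofactor X j r) (y r)))
                                          (sym (*-distribˡ-sum (sign (toℕ r) * y r) (λ j → X i j * cofactor X j r)))) ⟩
    sum T
      ≈⟨ sum-T ⟩
    det X * y i ∎
    where
    regroup : ∀ x s e w → x * ((s * e) * w) ≈ (s * w) * (x * e)
    regroup = solve 4 (λ x s e w → x :* ((s :* e) :* w) := (s :* w) :* (x :* e)) refl
    T : Vec (suc q)
    T r = (sign (toℕ r) * y r) * sum (λ j → X i j * cofactor X j r)
    Q : Matrix (suc (suc q)) (suc (suc q))
    Q = (y i ∷ X i) ∷ (λ r → y r ∷ X r)
    detQ≈0 : det Q ≈ 0#
    detQ≈0 = det-equal-rows Q zero (suc i) (λ ()) (λ _ → refl)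
    minor-suc : ∀ r → det (minor (suc r) Q) ≈ sum (λ j → X i j * cofactor X j r)
    minor-suc r = begin
      det (minor (suc r) Q)                      ≈⟨ det-cong {X = minor (suc r) Q} {Y = (λ j′ → sum (λ j → X i j * δ j j′)) ∷ (X ∘ punchIn r)}
                                                      (λ { zero j → sym (sum-*δˡ (X i) j) ; (suc ρ) j → refl }) ⟩
      det ((λ j′ → sum (λ j → X i j * δ j j′)) ∷ (X ∘ punchIn r))
                                                 ≈⟨ det-∷-lincomb (X i) δ (X ∘ punchIn r) ⟩
      sum (λ j → X i j * cofactor X j r)         ∎
    term-suc : ∀ r → laplaceTerm Q (suc r) ≈ - T r
    term-suc r = trans (*-congˡ (minor-suc r))
      (solve 3 (λ s w z → (:- s :* w) :* z := :- ((s :* w) :* z)) refl (sign (toℕ r)) (y r) _)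
    other-terms : sum (laplaceTerm Q ∘ suc) ≈ - sum T
    other-terms = trans (sum-cong-≋ {x = laplaceTerm Q ∘ suc} {y = λ r → - T r} term-suc) (-‿distrib-sum T)
    sum-T : sum T ≈ det X * y i
    sum-T = begin
      sum T
        ≈⟨ solve 3 (λ t w d → t := w :* d :- ((con (1 , 0) :* w) :* d :- t)) refl (sum T) (y i) (det X) ⟩
      y i * det X - ((1# * y i) * det X - sum T)
        ≈⟨ +-congˡ (-‿cong (+-congˡ (sym other-terms))) ⟩
      y i * det X - det Q
        ≈⟨ +-congˡ (trans (-‿cong detQ≈0) -0#≈0#) ⟩
      y i * det X + 0#
        ≈⟨ trans (+-identityʳ _) (*-comm _ _) ⟩
      det X * y i
        ∎

  ¬¬-∀⊎∃¬ : ∀ {p} n (P : Fin n → Set p) → ¬ ¬ ((∀ i → P i) ⊎ ∃ λ i → ¬ P i)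
  ¬¬-∀⊎∃¬ zero    P k = k (inj₁ λ ())
  ¬¬-∀⊎∃¬ (suc n) P k = ¬¬-excluded-middle λ
    { (yes P0) → ¬¬-∀⊎∃¬ n (P ∘ suc) λ
        { (inj₁ ∀P)       → k (inj₁ λ { zero → P0 ; (suc i) → ∀P i })
        ; (inj₂ (i , ¬P)) → k (inj₂ (suc i , ¬P)) }
    ; (no ¬P0) → k (inj₂ (zero , ¬P0)) }

  sign²≈1 : ∀ n → sign n * sign n ≈ 1#
  sign²≈1 zero    = *-identityˡ 1#
  sign²≈1 (suc n) = trans (solve 1 (λ s → :- s :* :- s := s :* s) refl (sign n)) (sign²≈1 n)

  -- Gaussian elimination of the first column with the pivot X p 0, whose inverse is π.
  module PivotElimination {q} (X : Matrix (suc q) (suc q)) (p : Fin (suc q))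
                          (π : Carrier) (Xpπ≈1 : X p zero * π ≈ 1#) where

    μ : Vec (suc q)
    μ = updateAt (λ ρ → - (X ρ zero * π)) p (λ _ → 0#)

    μp≈0 : μ p ≈ 0#
    μp≈0 = reflexive (updateAt-updates p _)

    μ-there : ∀ ρ → ρ ≢ p → μ ρ ≡ - (X ρ zero * π)
    μ-there ρ ρ≢p = updateAt-minimal ρ p _ ρ≢p

    X′ : Matrix (suc q) (suc q)
    X′ = addMultiplesOfRow X p μ

    X′-pivot : X′ p zero ≈ X p zero
    X′-pivot = trans (+-congˡ (trans (*-congʳ μp≈0) (zeroˡ _))) (+-identityʳ _)

    X′-column₀ : ∀ ρ → ρ ≢ p → X′ ρ zero ≈ 0#
    X′-column₀ ρ ρ≢p = begin
      X ρ zero + μ ρ * X p zero                  ≈⟨ +-congˡ (*-congʳ (reflexive (μ-there ρ ρ≢p))) ⟩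
      X ρ zero + - (X ρ zero * π) * X p zero     ≈⟨ solve 3 (λ x π′ a → x :+ :- (x :* π′) :* a := x :- x :* (a :* π′)) refl _ π _ ⟩
      X ρ zero - X ρ zero * (X p zero * π)       ≈⟨ +-congˡ (-‿cong (*-congˡ Xpπ≈1)) ⟩
      X ρ zero - X ρ zero * 1#                   ≈⟨ solve 1 (λ x → x :- x :* con (1 , 0) := con (0 , 0)) refl _ ⟩
      0#                                         ∎

    det-minor≈0 : det X ≈ 0# → det (minor p X′) ≈ 0#
    det-minor≈0 detX≈0 = begin
      D
        ≈⟨ sym (trans (*-congʳ (trans (*-cong (sign²≈1 (toℕ p)) Xpπ≈1) (*-identityˡ 1#))) (*-identityˡ D)) ⟩
      ((sign (toℕ p) * sign (toℕ p)) * (X p zero * π)) * D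
        ≈⟨ solve 4 (λ s a π′ d → ((s :* s) :* (a :* π′)) :* d := (s :* π′) :* ((s :* a) :* d)) refl _ _ π D ⟩
      (sign (toℕ p) * π) * ((sign (toℕ p) * X p zero) * D)
        ≈⟨ *-congˡ (trans (*-congʳ (*-congˡ (sym X′-pivot))) pivot-term≈0) ⟩
      (sign (toℕ p) * π) * 0#
        ≈⟨ zeroʳ _ ⟩
      0#
        ∎
      where
      D = det (minor p X′)
      pivot-term≈0 : laplaceTerm X′ p ≈ 0#
      pivot-term≈0 = trans (sym (sum-single (laplaceTerm X′) p (λ ρ ρ≢p →
                       trans (*-congʳ (trans (*-congˡ (X′-column₀ ρ ρ≢p)) (zeroʳ _))) (zeroˡ _))))
                     (trans (det-addMultiplesOfRow X p μ μp≈0) detX≈0)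

    minor-injective : Injective X → Injective (minor p X′)
    minor-injective inj w Mw≈0 c = inj v Xv≈0 (suc c)
      where
      R : Fin (suc q) → Carrier
      R ρ = sum (λ c′ → X ρ (suc c′) * w c′)
      v : Vec (suc q)
      v = (- (π * R p)) ∷ w
      Xv≈0 : (X · v) ≈ᵛ 0ᵛ
      Xv≈0 ρ with ρ ≟ p
      ... | yes ≡.refl = begin
        X ρ zero * - (π * R ρ) + R ρ   ≈⟨ solve 3 (λ a π′ r → a :* :- (π′ :* r) :+ r := r :- (a :* π′) :* r) refl _ π _ ⟩
        R ρ - (X ρ zero * π) * R ρ     ≈⟨ +-congˡ (-‿cong (*-congʳ Xpπ≈1)) ⟩
        R ρ - 1# * R ρ                 ≈⟨ solve 1 (λ r → r :- con (1 , 0) :* r := con (0 , 0)) refl _ ⟩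
        0#                             ∎
      ... | no ρ≢p = begin
        X ρ zero * - (π * R p) + R ρ   ≈⟨ solve 4 (λ a π′ s r → a :* :- (π′ :* s) :+ r := r :+ :- (a :* π′) :* s) refl _ π _ _ ⟩
        R ρ + - (X ρ zero * π) * R p   ≈⟨ +-congˡ (*-congʳ (reflexive (≡.sym (μ-there ρ ρ≢p)))) ⟩
        R ρ + μ ρ * R p                ≈⟨ +-congˡ (*-distribˡ-sum (μ ρ) (λ c′ → X p (suc c′) * w c′)) ⟩
        R ρ + sum (λ c′ → μ ρ * (X p (suc c′) * w c′))
                                       ≈⟨ sym (∑-distrib-+ (λ c′ → X ρ (suc c′) * w c′) (λ c′ → μ ρ * (X p (suc c′) * w c′))) ⟩
        sum (λ c′ → X ρ (suc c′) * w c′ + μ ρ * (X p (suc c′) * w c′))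
                                       ≈⟨ sum-cong-≋ {q} (λ c′ → solve 4 (λ x m y w′ → x :* w′ :+ m :* (y :* w′) := (x :+ m :* y) :* w′) refl _ _ _ _) ⟩
        sum (λ c′ → X′ ρ (suc c′) * w c′)
                                       ≈⟨ ≡.subst (λ t → sum (λ c′ → X′ t (suc c′) * w c′) ≈ 0#) (punchIn-punchOut p≢ρ) (Mw≈0 (punchOut p≢ρ)) ⟩
        0#                             ∎
        where
        p≢ρ : p ≢ ρ
        p≢ρ = ρ≢p ∘ ≡.sym

  -- Equality in K is not decidable, so a pivot in the first column is only found under ¬¬;
  -- that suffices because the goal is ⊥.
  injective⇒det≉0 : ∀ {q} (X : Matrix q q) → Injective X → ¬ det X ≈ 0#
  injective⇒det≉0 {zero}  X inj det≈0 = 0≉1 (sym det≈0)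
  injective⇒det≉0 {suc q} X inj det≈0 = ¬¬-∀⊎∃¬ (suc q) (λ i → X i zero ≈ 0#) λ
    { (inj₁ column₀≈0) → 0≉1 (sym (trans (sym (δ-diag {suc q} zero))
                           (inj (δ zero) (λ i → trans (sum-*δʳ (X i) zero) (column₀≈0 i)) zero)))
    ; (inj₂ (p , Xp≉0)) → eliminate p Xp≉0 }
    where
    eliminate : ∀ p → ¬ X p zero ≈ 0# → ⊥
    eliminate p Xp≉0 with inverse (X p zero) Xp≉0
    ... | π , Xpπ≈1 = injective⇒det≉0 (minor p X′) (minor-injective inj) (det-minor≈0 det≈0)
      where open PivotElimination X p π Xpπ≈1

  injective⇒rightInverse : ∀ {q} (X : Matrix q q) → Injective X →
                           Σ (Vec q → Vec q) λ Y → ∀ y → (X · Y y) ≈ᵛ y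
  injective⇒rightInverse {zero}  X inj = (λ y ()) , (λ y ())
  injective⇒rightInverse {suc q} X inj with inverse (det X) (injective⇒det≉0 X inj)
  ... | π , detπ≈1 = (λ y j → π * adjugate X y j) , λ y i → begin
    sum (λ j → X i j * (π * adjugate X y j))
      ≈⟨ sum-cong-≋ {suc q} (λ j → solve 3 (λ x p a → x :* (p :* a) := p :* (x :* a)) refl (X i j) π (adjugate X y j)) ⟩
    sum (λ j → π * (X i j * adjugate X y j)) ≈⟨ sym (*-distribˡ-sum π (λ j → X i j * adjugate X y j)) ⟩
    π * (X · adjugate X y) i                 ≈⟨ *-congˡ (cramer X y i) ⟩
    π * (det X * y i)                        ≈⟨ solve 3 (λ p d w → p :* (d :* w) := (d :* p) :* w) refl π (det X) (y i) ⟩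
    (det X * π) * y i                        ≈⟨ trans (*-congʳ detπ≈1) (*-identityˡ _) ⟩
    y i                                      ∎

  -- Pad X with zero rows to a square matrix: it stays injective but has a zero row.
  injective⇒≤ : ∀ {m k} (X : Matrix m k) → Injective X → k ≤ m
  injective⇒≤ {m} {k} X inj with k ℕ.≤? m
  ... | yes k≤m = k≤m
  ... | no  k≰m = ⊥-elim (injective⇒det≉0 X̃ X̃-injective (det-zero-row X̃ (fromℕ< m<k) X̃-m≈0))
    where
    m<k : m < k
    m<k = ≰⇒> k≰m
    X̃ : Matrix k k
    X̃ t with toℕ t ℕ.<? m
    ... | yes t<m = X (fromℕ< t<m)
    ... | no  _   = 0ᵛ
    X̃-inject : ∀ i → X̃ (inject≤ i (<⇒≤ m<k)) ≈ᵛ X i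
    X̃-inject i with toℕ (inject≤ i (<⇒≤ m<k)) ℕ.<? m
    ... | yes t<m = λ j → reflexive (≡.cong (λ r → X r j)
                      (toℕ-injective (≡.trans (toℕ-fromℕ< t<m) (toℕ-inject≤ i (<⇒≤ m<k)))))
    ... | no  t≮m = ⊥-elim (t≮m (≡.subst (_< m) (≡.sym (toℕ-inject≤ i (<⇒≤ m<k))) (toℕ<n i)))
    X̃-m≈0 : X̃ (fromℕ< m<k) ≈ᵛ 0ᵛ
    X̃-m≈0 with toℕ (fromℕ< m<k) ℕ.<? m
    ... | yes m<m = ⊥-elim (<-irrefl (toℕ-fromℕ< m<k) m<m)
    ... | no  _   = λ _ → refl
    X̃-injective : Injective X̃
    X̃-injective v X̃v≈0 = inj v (λ i → trans (sym (sum-cong-≋ {k} (λ j → *-congʳ (X̃-inject i j)))) (X̃v≈0 _))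

  columnsOf : ∀ {k q} → (Fin k → Vec q) → Matrix q k
  columnsOf x t j = x j t

  ·-columnsOf : ∀ {m q k} (M : Matrix m q) (x : Fin k → Vec q) (f : Fin k → Vec m) →
                (∀ j → (M · x j) ≈ᵛ f j) → ∀ b → (M · (columnsOf x · b)) ≈ᵛ (λ i → sum (λ j → b j * f j i))
  ·-columnsOf {k = k} M x f Mx≈f b i =
    trans (·-lincomb M b x i) (sum-cong-≋ {k} (λ j → *-congˡ (Mx≈f j i)))

  independent-preimages-injective : ∀ {m q k} (M : Matrix m q) (x : Fin k → Vec q) (f : Fin k → Vec m) →
                                    (∀ j → (M · x j) ≈ᵛ f j) → LinIndep f → Injective (columnsOf x)
  independent-preimages-injective M x f Mx≈f indep b Xb≈0 =
    indep b (λ i → trans (sym (·-columnsOf M x f Mx≈f b i)) (·-0ᵛ M Xb≈0 i))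

  independent-in-image⇒≤ : ∀ {m q k} (M : Matrix m q) (f : Fin k → Vec m) →
                           (∀ j → Im M (f j)) → LinIndep f → k ≤ q
  independent-in-image⇒≤ M f f∈ImM indep =
    injective⇒≤ _ (independent-preimages-injective M (proj₁ ∘ f∈ImM) f (proj₂ ∘ f∈ImM) indep)

  Im-DimLE : ∀ {m q} (M : Matrix m q) → DimLE (Im M) q
  Im-DimLE M k = independent-in-image⇒≤ M

  injective⇒Rank : ∀ {m q} (M : Matrix m q) → Injective M → Rank M q
  injective⇒Rank {q = q} M inj = Im-DimLE M , (λ j i → M i j) , (λ j → δ j , λ i → sum-*δʳ (M i) j) ,
    λ a Σa·M≈0 → inj a (λ i → trans (sum-cong-≋ {q} (λ j → *-comm _ _)) (Σa·M≈0 i))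

  Im-lincomb : ∀ {m n k} (N : Matrix m n) (f : Fin k → Vec m) → (∀ j → Im N (f j)) →
               ∀ b → Im N (λ i → sum (λ j → b j * f j i))
  Im-lincomb N f f∈ImN b = columnsOf (proj₁ ∘ f∈ImN) · b , ·-columnsOf N (proj₁ ∘ f∈ImN) f (proj₂ ∘ f∈ImN) b

  independent-in-image⇒injective×spanning : ∀ {m q} (M : Matrix m q) (f : Fin q → Vec m) →
    (∀ j → Im M (f j)) → LinIndep f →
    Injective M × (∀ u → ∃ λ b → (M · u) ≈ᵛ (λ i → sum (λ j → b j * f j i)))
  independent-in-image⇒injective×spanning {q = q} M f f∈ImM indep = M-injective , (λ u → Y u , M·u≈ u)
    where
    x : Fin q → Vec q
    x = proj₁ ∘ f∈ImM
    X : Matrix q q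
    X = columnsOf x
    X-inverse : Σ (Vec q → Vec q) λ Y → ∀ y → (X · Y y) ≈ᵛ y
    X-inverse = injective⇒rightInverse X (independent-preimages-injective M x f (proj₂ ∘ f∈ImM) indep)
    Y : Vec q → Vec q
    Y = proj₁ X-inverse
    M·u≈ : ∀ u → (M · u) ≈ᵛ (λ i → sum (λ j → Y u j * f j i))
    M·u≈ u i = trans (·-cong M (λ t → sym (proj₂ X-inverse u t)) i) (·-columnsOf M x f (proj₂ ∘ f∈ImM) (Y u) i)
    M-injective : Injective M
    M-injective u Mu≈0 t = trans (sym (proj₂ X-inverse u t)) (·-0ᵛ X Yu≈0 t)
      where
      Yu≈0 : Y u ≈ᵛ 0ᵛ
      Yu≈0 = indep (Y u) (λ i → trans (sym (M·u≈ u i)) (Mu≈0 i))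

module CommutingExtensions {c ℓ} (K : Field c ℓ) where

  open import Data.Fin using (Fin; _↑ˡ_; _↑ʳ_)
  open import Data.Fin.Properties using (splitAt-↑ˡ; splitAt-↑ʳ)
  open import Data.Nat as ℕ using (ℕ)
  import Data.Nat.Properties as ℕₚ
  open import Data.Product using (∃; _×_; _,_; proj₁; proj₂)
  open import Data.Vec.Functional using (_++_)
  open import Function using (_∘_)
  open import Relation.Binary.PropositionalEquality as ≡ using (_≡_)

  open Field K hiding (zero)
  open LinearAlgebra K
  open import Algebra.Properties.Semiring.Sum semiring using (sum; sum-cong-≋)
  open import Relation.Binary.Reasoning.Setoid setoid
  open CommutativeRingSolver commutativeRing using (solve; _:=_; _:+_; :-_; _:-_)
  open MatrixAlgebra K
  open Invertibility K

  block-topLeft : ∀ {n s} (A : Matrix n n) B C D (i j : Fin n) → block {n} {s} A B C D (i ↑ˡ s) (j ↑ˡ s) ≡ A i j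
  block-topLeft {n} {s} A B C D i j rewrite splitAt-↑ˡ n i s | splitAt-↑ˡ n j s = ≡.refl

  block-topRight : ∀ {n s} (A : Matrix n n) B C D (i : Fin n) (j : Fin s) → block A B C D (i ↑ˡ s) (n ↑ʳ j) ≡ B i j
  block-topRight {n} {s} A B C D i j rewrite splitAt-↑ˡ n i s | splitAt-↑ʳ n s j = ≡.refl

  block-bottomLeft : ∀ {n s} (A : Matrix n n) B C D (i : Fin s) (j : Fin n) → block A B C D (n ↑ʳ i) (j ↑ˡ s) ≡ C i j
  block-bottomLeft {n} {s} A B C D i j rewrite splitAt-↑ʳ n s i | splitAt-↑ˡ n j s = ≡.refl

  block-⊗-topLeft : ∀ {n s} (A A′ : Matrix n n) (B B′ : Matrix n s) (C C′ : Matrix s n) (D D′ : Matrix s s) (i j : Fin n) →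
                    (block A B C D ⊗ block A′ B′ C′ D′) (i ↑ˡ s) (j ↑ˡ s) ≈ (A ⊗ A′) i j + (B ⊗ C′) i j
  block-⊗-topLeft {n} {s} A A′ B B′ C C′ D D′ i j = trans (sum-splitAt {n} {s} _)
    (+-cong (sum-cong-≋ {n} (λ t → reflexive (≡.cong₂ _*_ (block-topLeft A B C D i t) (block-topLeft A′ B′ C′ D′ t j))))
            (sum-cong-≋ {s} (λ t → reflexive (≡.cong₂ _*_ (block-topRight A B C D i t) (block-bottomLeft A′ B′ C′ D′ t j)))))

  x+y≈z+w⇒x-z≈w-y : ∀ {x y z w} → x + y ≈ z + w → x - z ≈ w - y
  x+y≈z+w⇒x-z≈w-y {x} {y} {z} {w} x+y≈z+w = begin
    x - z                           ≈⟨ solve 4 (λ x y z w → x :- z := (x :+ y) :- (z :+ w) :+ (w :- y)) refl x y z w ⟩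
    ((x + y) - (z + w)) + (w - y)   ≈⟨ +-congʳ (trans (+-congʳ x+y≈z+w) (-‿inverseʳ _)) ⟩
    0# + (w - y)                    ≈⟨ +-identityˡ _ ⟩
    w - y                           ∎

  3s≤n⇒3[n+s]≤4n : ∀ {n s} → 3 ℕ.* s ℕ.≤ n → 3 ℕ.* (n ℕ.+ s) ℕ.≤ 4 ℕ.* n
  3s≤n⇒3[n+s]≤4n {n} {s} 3s≤n =
    ≡.subst₂ ℕ._≤_ (≡.sym (ℕₚ.*-distribˡ-+ 3 n s)) (ℕₚ.+-comm (3 ℕ.* n) n) (ℕₚ.+-monoʳ-≤ (3 ℕ.* n) 3s≤n)

  module CommutingExtension {n s p : ℕ}
    (A : Fin p → Matrix n n) (B : Fin p → Matrix n s) (C : Fin p → Matrix s n) (D : Fin p → Matrix s s)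
    (commute : ∀ a b → (block (A a) (B a) (C a) (D a) ⊗ block (A b) (B b) (C b) (D b))
                     ≋ (block (A b) (B b) (C b) (D b) ⊗ block (A a) (B a) (C a) (D a)))
    where

    commutator≋ : ∀ a b → ⟦ A a , A b ⟧ ≋ ((B b ⊗ C a) ⊖ (B a ⊗ C b))
    commutator≋ a b i j = x+y≈z+w⇒x-z≈w-y (begin
      (A a ⊗ A b) i j + (B a ⊗ C b) i j   ≈⟨ sym (block-⊗-topLeft (A a) (A b) (B a) (B b) (C a) (C b) (D a) (D b) i j) ⟩
      _                                   ≈⟨ commute a b (i ↑ˡ s) (j ↑ˡ s) ⟩
      _                                   ≈⟨ block-⊗-topLeft (A b) (A a) (B b) (B a) (C b) (C a) (D b) (D a) i j ⟩
      (A b ⊗ A a) i j + (B b ⊗ C a) i j   ∎)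

    commutator-· : ∀ a b x → (⟦ A a , A b ⟧ · x) ≈ᵛ (λ i → (B b · (C a · x)) i - (B a · (C b · x)) i)
    commutator-· a b x i = trans (·-congˡ (commutator≋ a b) x i)
      (trans (⊖-· (B b ⊗ C a) (B a ⊗ C b) x i) (+-cong (⊗-· (B b) (C a) x i) (-‿cong (⊗-· (B a) (C b) x i))))

    module Triple (k l m : Fin p) where

      V W : Subspace n
      V = Im ⟦ A k , A l ⟧ ⊕ₛ Im ⟦ A k , A m ⟧
      W = (Im (B k) ⊕ₛ Im (B l)) ⊕ₛ Im (B m)

      N : Matrix n (n ℕ.+ n)
      N = ⟦ A k , A l ⟧ ∣ ⟦ A k , A m ⟧

      M : Matrix n ((s ℕ.+ s) ℕ.+ s)
      M = (B k ∣ B l) ∣ B m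

      M-·-++ : ∀ x y z → (M · ((x ++ y) ++ z)) ≈ᵛ (((B k · x) +ᵛ (B l · y)) +ᵛ (B m · z))
      M-·-++ x y z i = trans (∣-·-++ (B k ∣ B l) (B m) (x ++ y) z i) (+-congʳ (∣-·-++ (B k) (B l) x y i))

      W≐ImM : W ≐ Im M
      W≐ImM = ≐-trans (⊕ₛ-congʳ (Im (B m)) (Im-∣ (B k) (B l))) (Im-∣ (B k ∣ B l) (B m))

      V⊆ImM : ∀ v → V v → Im M v
      V⊆ImM v (_ , _ , (x , hx) , (y , hy) , v≈) = (α ++ β) ++ γ , λ i → begin
        (M · ((α ++ β) ++ γ)) i
          ≈⟨ M-·-++ α β γ i ⟩
        ((B k · α) i + (B l · β) i) + (B m · γ) i
          ≈⟨ +-congʳ (+-congʳ (trans (·-neg (B k) _ i) (-‿cong (·-+ᵛ (B k) _ _ i)))) ⟩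
        (- ((B k · (C l · x)) i + (B k · (C m · y)) i) + (B l · β) i) + (B m · γ) i
          ≈⟨ solve 4 (λ a b c d → (:- (a :+ b) :+ c) :+ d := (c :- a) :+ (d :- b)) refl _ _ _ _ ⟩
        ((B l · β) i - (B k · (C l · x)) i) + ((B m · γ) i - (B k · (C m · y)) i)
          ≈⟨ sym (+-cong (commutator-· k l x i) (commutator-· k m y i)) ⟩
        (⟦ A k , A l ⟧ · x) i + (⟦ A k , A m ⟧ · y) i
          ≈⟨ trans (+-cong (hx i) (hy i)) (sym (v≈ i)) ⟩
        v i
          ∎
        where
        α β γ : Vec s
        α r = - ((C l · x) +ᵛ (C m · y)) r
        β = C k · x
        γ = C k · y

      s+s+s≡3s : (s ℕ.+ s) ℕ.+ s ≡ 3 ℕ.* s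
      s+s+s≡3s = ≡.trans (ℕₚ.+-assoc s s s) (≡.cong (λ t → s ℕ.+ (s ℕ.+ t)) (≡.sym (ℕₚ.+-identityʳ s)))

      dim-bound : DimLE V (3 ℕ.* s)
      dim-bound d f f∈V indep = ≡.subst (d ℕ.≤_) s+s+s≡3s (Im-DimLE M d f (λ j → V⊆ImM (f j) (f∈V j)) indep)

      module Extremal (dim : Dim V (3 ℕ.* s)) where

        basis : DimGE V ((s ℕ.+ s) ℕ.+ s)
        basis = ≡.subst (DimGE V) (≡.sym s+s+s≡3s) (proj₂ dim)

        f : Fin ((s ℕ.+ s) ℕ.+ s) → Vec n
        f = proj₁ basis

        f∈V : ∀ j → V (f j)
        f∈V = proj₁ (proj₂ basis)

        spanning : Injective M × (∀ u → ∃ λ b → (M · u) ≈ᵛ (λ i → sum (λ j → b j * f j i)))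
        spanning = independent-in-image⇒injective×spanning M f (λ j → V⊆ImM (f j) (f∈V j)) (proj₂ (proj₂ basis))

        M-injective : Injective M
        M-injective = proj₁ spanning

        f∈ImN : ∀ j → Im N (f j)
        f∈ImN j = proj₁ (Im-∣ ⟦ A k , A l ⟧ ⟦ A k , A m ⟧) (f j) (f∈V j)

        ImM⊆V : ∀ v → Im M v → V v
        ImM⊆V v (u , Mu≈v) = proj₂ (Im-∣ ⟦ A k , A l ⟧ ⟦ A k , A m ⟧) v (proj₁ Nw≈Σ , λ i →
            trans (proj₂ Nw≈Σ i) (trans (sym (proj₂ (proj₂ spanning u) i)) (Mu≈v i)))
          where
          Nw≈Σ : Im N (λ i → sum (λ j → proj₁ (proj₂ spanning u) j * f j i))
          Nw≈Σ = Im-lincomb N f f∈ImN (proj₁ (proj₂ spanning u))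

        V≐W : V ≐ W
        V≐W = (λ v → proj₂ W≐ImM v ∘ V⊆ImM v) , (λ v → ImM⊆V v ∘ proj₁ W≐ImM v)

        Bkl-injective : Injective (B k ∣ B l)
        Bkl-injective = ∣-injectiveˡ (B k ∣ B l) (B m) M-injective

        direct : DirectSum₃ (B k) (B l) (B m)
        direct x y z sum≈0 = ·-0ᵛ (B k) (proj₁ xy≈0) , ·-0ᵛ (B l) (proj₂ xy≈0) , ·-0ᵛ (B m) (proj₂ xyz≈0)
          where
          xyz≈0 : ((x ++ y) ≈ᵛ 0ᵛ) × (z ≈ᵛ 0ᵛ)
          xyz≈0 = ++-≈0ᵛ (x ++ y) z (M-injective ((x ++ y) ++ z) (λ i → trans (M-·-++ x y z i) (sum≈0 i)))
          xy≈0 : (x ≈ᵛ 0ᵛ) × (y ≈ᵛ 0ᵛ)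
          xy≈0 = ++-≈0ᵛ x y (proj₁ xyz≈0)

        consequences : (3 ℕ.* (n ℕ.+ s) ℕ.≤ 4 ℕ.* n)
                       × Rank (B k) s × Rank (B l) s × Rank (B m) s
                       × (V ≐ W) × DirectSum₃ (B k) (B l) (B m)
        consequences = 3s≤n⇒3[n+s]≤4n (≡.subst (ℕ._≤ n) s+s+s≡3s (injective⇒≤ M M-injective))
                     , injective⇒Rank (B k) (∣-injectiveˡ (B k) (B l) Bkl-injective)
                     , injective⇒Rank (B l) (∣-injectiveʳ (B k) (B l) Bkl-injective)
                     , injective⇒Rank (B m) (∣-injectiveʳ (B k ∣ B l) (B m) M-injective)
                     , V≐W , direct

open import Level using (Level)
open import Data.Nat using (ℕ; _+_; _*_; _≤_)
open import Data.Fin using (Fin)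
open import Data.Product using (_×_; _,_)
open import Relation.Binary.PropositionalEquality using (_≢_)

-- The indices k, l, m need not be distinct.
proposition1 : ∀ {c ℓ : Level} (K : Field c ℓ) → let open LinearAlgebra K in
    ∀ (n s p : ℕ)
      (A : Fin p → Matrix n n) (B : Fin p → Matrix n s)
      (C : Fin p → Matrix s n) (D : Fin p → Matrix s s) →
    (∀ i j → (block (A i) (B i) (C i) (D i) ⊗ block (A j) (B j) (C j) (D j))
           ≋ (block (A j) (B j) (C j) (D j) ⊗ block (A i) (B i) (C i) (D i))) →
    ∀ (k l m : Fin p) → k ≢ l → k ≢ m → l ≢ m →
    DimLE (Im ⟦ A k , A l ⟧ ⊕ₛ Im ⟦ A k , A m ⟧) (3 * s)
    × (Dim (Im ⟦ A k , A l ⟧ ⊕ₛ Im ⟦ A k , A m ⟧) (3 * s) →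
         (3 * (n + s) ≤ 4 * n)
         × Rank (B k) s × Rank (B l) s × Rank (B m) s
         × ((Im ⟦ A k , A l ⟧ ⊕ₛ Im ⟦ A k , A m ⟧)
              ≐ ((Im (B k) ⊕ₛ Im (B l)) ⊕ₛ Im (B m)))
         × DirectSum₃ (B k) (B l) (B m))
proposition1 K n s p A B C D commute k l m _ _ _ = dim-bound , Extremal.consequences
  where
  open CommutingExtensions K
  open CommutingExtension A B C D commute
  open Triple k l m
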